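{- Let $\tau=(\rho',t,k,\theta',1,t-1)\in\mathfrak M_k$ be such that $\rho'_a>t>\theta'_b$ for all $a,b$. Let $\rho$ be the permutation obtained by decreasing each entry of $\rho'$ by $t$, and $\theta$ the permutation obtained by decreasing each entry of $\theta'$ by $1$. Then $$N_\tau(x)=\frac{1-x^2N_\rho(x)\widetilde N_\theta(x)}{1-x-x^2\left(N_\rho(x)+\widetilde N_\theta(x)\right)},\qquad\text{where }\widetilde N_\theta(x)=\frac{1}{1-x-x^2N_\theta(x)}.$$
   Context: A permutation $\pi=\pi_1\cdots\pi_n$ is a Motzkin permutation if it avoids the pattern $132$ (no $i<j<k$ with $\pi_i<\pi_k<\pi_j$) and there are no indices $a<b$ with $\pi_a<\pi_b<\pi_{b+1}$; $\mathfrak M_n$ is the set of them. For a permutation $\sigma$, $N_\sigma(x)=\sum_{n\ge0}|\mathfrak M_n(\sigma)|x^n$, where $\mathfrak M_n(\sigma)$ is the set of Motzkin permutations of length $n$ avoiding $\sigma$ classically. Parenthesized lists denote concatenation of sequences. -}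

module Defs where

open import Data.Nat using (ℕ; zero; suc; _<ᵇ_; _∸_)
open import Data.Bool using (Bool; true; false; not; _∧_; _∨_; _xor_)
open import Data.Product using (_×_; _,_; proj₁; proj₂)
open import Data.List using (List; []; _∷_; _++_; map; concatMap; zip; length; filterᵇ; sum)
open import Data.Integer as ℤ using (ℤ; +_)
open import Relation.Binary.PropositionalEquality using (_≡_)
open import Data.List as L using ()

anyB : {A : Set} → (A → Bool) → List A → Bool
anyB p [] = false
anyB p (x ∷ xs) = p x ∨ anyB p xs

allB : {A : Set} → (A → Bool) → List A → Bool
allB p [] = true
allB p (x ∷ xs) = p x ∧ allB p xs

inserts : ℕ → List ℕ → List (List ℕ)
inserts x [] = (x ∷ []) ∷ []
inserts x (y ∷ ys) = (x ∷ y ∷ ys) ∷ map (y ∷_) (inserts x ys)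

perms : ℕ → List (List ℕ)
perms zero = [] ∷ []
perms (suc n) = concatMap (inserts (suc n)) (perms n)

subseqs : List ℕ → List (List ℕ)
subseqs [] = [] ∷ []
subseqs (x ∷ xs) = map (x ∷_) (subseqs xs) ++ subseqs xs

_==ᵇ_ : Bool → Bool → Bool
a ==ᵇ b = not (a xor b)

sameOrder : List ℕ → List ℕ → Bool
sameOrder [] [] = true
sameOrder (a ∷ as) (b ∷ bs) =
  allB (λ p → ((a <ᵇ proj₁ p) ==ᵇ (b <ᵇ proj₂ p)) ∧ ((proj₁ p <ᵇ a) ==ᵇ (proj₂ p <ᵇ b))) (zip as bs)
  ∧ sameOrder as bs
sameOrder _ _ = false

contains : List ℕ → List ℕ → Bool
contains π σ = anyB (λ s → sameOrder s σ) (subseqs π)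

-- noVinc pre rest: no a<b with π_a<π_b<π_{b+1}, where pre is the (reversed) prefix
noVinc : List ℕ → List ℕ → Bool
noVinc pre [] = true
noVinc pre (x ∷ []) = true
noVinc pre (x ∷ rest@(y ∷ r)) =
  not ((x <ᵇ y) ∧ anyB (λ a → a <ᵇ x) pre) ∧ noVinc (x ∷ pre) rest

isMotzkin : List ℕ → Bool
isMotzkin π = not (contains π (1 ∷ 3 ∷ 2 ∷ [])) ∧ noVinc [] π

countM : List ℕ → ℕ → ℕ
countM σ n = length (filterᵇ (λ π → isMotzkin π ∧ not (contains π σ)) (perms n))

Series : Set
Series = ℕ → ℤ

upTo' : ℕ → List ℕ
upTo' zero = zero ∷ []
upTo' (suc n) = upTo' n ++ (suc n ∷ [])

_⊕_ : Series → Series → Series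
(f ⊕ g) n = f n ℤ.+ g n

_⊖_ : Series → Series → Series
(f ⊖ g) n = f n ℤ.- g n

_⊛_ : Series → Series → Series
(f ⊛ g) n = L.foldr ℤ._+_ (+ 0) (map (λ i → f i ℤ.* g (n ∸ i)) (upTo' n))

oneS : Series
oneS zero = + 1
oneS (suc _) = + 0

xS : Series
xS (suc zero) = + 1
xS _ = + 0

x²S : Series
x²S (suc (suc zero)) = + 1
x²S _ = + 0

_≈S_ : Series → Series → Set
f ≈S g = ∀ n → f n ≡ g n

N : List ℕ → Series
N σ n = + countM σ n

module Submission where

-- A Motzkin permutation of length n + 1 either is (n + 1, β) with β Motzkin of length n, or is
-- (γ + (j + 1), j + 1, n + 1, β) with γ and β Motzkin of lengths i and j, i + j + 1 = n: avoiding 132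
-- puts everything before n + 1 above everything after it, and the excluded configuration
-- π_a < π_b < π_(b+1) makes the entry just before n + 1 smaller than everything before it.
-- The maximum of τ is not its first entry, so a leading maximum never helps to form τ.  Writing
-- τ = τ₁ τ₂ with τ₁ = (ρ′, t, k) above τ₂ = (θ′, 1, t − 1), both blocks end in their maximum and so
-- cannot be split as a skew sum; hence τ occurs in (γ + (j + 1), j + 1, n + 1, β) iff it occurs in γ
-- or in β, or ρ occurs in γ and τ₂ occurs in β.  Splitting by whether γ contains ρ gives
--   C = 1 + x C + x² (A C + D B)   for C = N_τ, A = N_ρ, B = N_τ₂ and D = C − A
-- (D counts the τ-avoiders containing ρ), while the same decomposition for τ₂ gives
-- B = 1 + x B + x² N_θ B, i.e. B = Ñ_θ.
-- Eliminating D yields C (1 − x − x² (A + B)) = 1 − x² A B.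

open import Defs
open import Data.Nat using (ℕ; _<_; _∸_)
open import Data.Bool using (true)
open import Data.List using (List; []; _∷_; _++_; map)
open import Data.List.Membership.Propositional using (_∈_)
open import Data.List.Relation.Unary.All using (All)
open import Relation.Binary.PropositionalEquality using (_≡_)

module Enumeration where

  open import Data.Nat using (ℕ; zero; suc; _+_; _*_; _∸_; _<ᵇ_; _<_; _≤_; s≤s; z≤n; z<s; _≟_)
  open import Data.Nat.Properties
  open import Data.Nat.ListAction using (sum)
  open import Data.Nat.Tactic.RingSolver using (solve-∀)
  open import Data.Bool using (Bool; true; false; not; _∧_; _∨_; T?)
  open import Data.Bool.Properties using (T-≡; ∧-assoc; ∧-identityʳ; ∧-zeroʳ; ∨-identityʳ; xor-comm; not-¬; ¬-not)
  open import Data.Product using (_×_; _,_; proj₁; proj₂; uncurry; ∃-syntax; ∃₂)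
  open import Data.Sum using (_⊎_; inj₁; inj₂)
  open import Data.Unit using (⊤; tt)
  open import Data.Empty using (⊥; ⊥-elim)
  open import Data.List
    using (List; []; _∷_; _++_; map; length; zip; _ʳ++_; applyUpTo; concatMap; cartesianProduct; filterᵇ; InitLast; initLast; _∷ʳ′_)
  open import Data.List.Properties
    using (++-identityʳ; ++-assoc; ∷-injectiveˡ; ∷-injectiveʳ; ∷ʳ-injective; ∷ʳ-injectiveˡ; length-++; length-map; length-applyUpTo;
           map-∘; map-id-local; map-cong; map-injective; filter-++)
  open import Data.List.Membership.Propositional using (_∈_; _∉_; find; lose)
  open import Data.List.Membership.Propositional.Properties
    using (∈-++⁻; ∈-++⁺ˡ; ∈-++⁺ʳ; ∈-map⁺; ∈-map⁻; ∈-∃++; ∈-concatMap⁺; ∈-concatMap⁻; ∈-applyUpTo⁺; ∈-filter⁺; ∈-filter⁻;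
           ∈-cartesianProduct⁺; ∈-cartesianProduct⁻)
  open import Data.List.Membership.DecPropositional _≟_ using (_∈?_)
  open import Data.List.Relation.Unary.Any using (here; there)
  open import Data.List.Relation.Unary.All as All using (All; []; _∷_)
  import Data.List.Relation.Unary.All.Properties as All
  open import Data.List.Relation.Unary.AllPairs using ([]; _∷_)
  open import Data.List.Relation.Unary.Unique.Propositional using (Unique)
  import Data.List.Relation.Unary.Unique.Propositional.Properties as Unique
  open import Data.List.Relation.Binary.Sublist.Propositional using (_⊆_; []; _∷_; _∷ʳ_; ⊆-refl; ⊆-trans; from∈)
  open import Data.List.Relation.Binary.Sublist.Propositional.Properties as Sublist using (All-resp-⊆)
  open import Function using (_∘_; Equivalence)
  open import Relation.Nullary using (¬_; yes; no; contradiction)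
  open import Relation.Binary.Definitions using (tri<; tri≈; tri>)
  open import Relation.Binary.PropositionalEquality


  ∧-true⁺ : ∀ {x y} → x ≡ true → y ≡ true → x ∧ y ≡ true
  ∧-true⁺ refl refl = refl

  ∧-true⁻ : ∀ {x y} → x ∧ y ≡ true → x ≡ true × y ≡ true
  ∧-true⁻ {true} e = refl , e

  ∨-true⁺ˡ : ∀ {x y} → x ≡ true → x ∨ y ≡ true
  ∨-true⁺ˡ refl = refl

  ∨-true⁺ʳ : ∀ {x y} → y ≡ true → x ∨ y ≡ true
  ∨-true⁺ʳ {true} _ = refl
  ∨-true⁺ʳ {false} e = e

  ∨-true⁻ : ∀ {x y} → x ∨ y ≡ true → x ≡ true ⊎ y ≡ true
  ∨-true⁻ {true} _ = inj₁ refl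
  ∨-true⁻ {false} e = inj₂ e

  not-true⁻ : ∀ {x} → not x ≡ true → x ≡ false
  not-true⁻ {false} _ = refl

  true⇔true⇒≡ : ∀ {x y} → (x ≡ true → y ≡ true) → (y ≡ true → x ≡ true) → x ≡ y
  true⇔true⇒≡ {false} {false} _ _ = refl
  true⇔true⇒≡ {false} {true} _ g = g refl
  true⇔true⇒≡ {true} {false} f _ = sym (f refl)
  true⇔true⇒≡ {true} {true} _ _ = refl

  not-∨ : ∀ x y → not (x ∨ y) ≡ not x ∧ not y
  not-∨ true y = refl
  not-∨ false y = refl

  not-∧-not : ∀ {x y} → (y ≡ true → x ≡ true) → not x ∧ not y ≡ not x
  not-∧-not {true} _ = refl
  not-∧-not {false} {false} _ = refl
  not-∧-not {false} {true} y⇒x with y⇒x refl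
  ... | ()

  <ᵇ-true : ∀ {m n} → m < n → (m <ᵇ n) ≡ true
  <ᵇ-true m<n = Equivalence.to T-≡ (<⇒<ᵇ m<n)

  <ᵇ-true⁻ : ∀ {m n} → (m <ᵇ n) ≡ true → m < n
  <ᵇ-true⁻ {m} {n} e = <ᵇ⇒< m n (Equivalence.from T-≡ e)

  <ᵇ-false : ∀ {m n} → n < m → (m <ᵇ n) ≡ false
  <ᵇ-false {m} {n} n<m with m <ᵇ n in e
  ... | false = refl
  ... | true = ⊥-elim (<-asym n<m (<ᵇ-true⁻ e))

  +-<ᵇ : ∀ c a b → ((a + c) <ᵇ (b + c)) ≡ (a <ᵇ b)
  +-<ᵇ c a b = true⇔true⇒≡
    (λ e → <ᵇ-true (+-cancelʳ-< c a b (<ᵇ-true⁻ {a + c} {b + c} e)))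
    (λ e → <ᵇ-true (+-monoˡ-< c (<ᵇ-true⁻ {a} {b} e)))

  anyB⁺ : ∀ {A : Set} (p : A → Bool) {xs x} → x ∈ xs → p x ≡ true → anyB p xs ≡ true
  anyB⁺ p (here refl) e = ∨-true⁺ˡ e
  anyB⁺ p {y ∷ _} (there x∈xs) e = ∨-true⁺ʳ {p y} (anyB⁺ p x∈xs e)

  anyB⁻ : ∀ {A : Set} (p : A → Bool) xs → anyB p xs ≡ true → ∃[ x ] (x ∈ xs × p x ≡ true)
  anyB⁻ p (x ∷ xs) e with ∨-true⁻ {p x} e
  ... | inj₁ px = x , here refl , px
  ... | inj₂ rest with anyB⁻ p xs rest
  ... | y , y∈xs , py = y , there y∈xs , py

  anyB-false⁺ : ∀ {A : Set} (p : A → Bool) {xs} → All (λ x → p x ≡ false) xs → anyB p xs ≡ false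
  anyB-false⁺ p [] = refl
  anyB-false⁺ p (px ∷ pxs) rewrite px = anyB-false⁺ p pxs

  anyB-++ : ∀ {A : Set} (p : A → Bool) xs ys → anyB p (xs ++ ys) ≡ anyB p xs ∨ anyB p ys
  anyB-++ p [] ys = refl
  anyB-++ p (x ∷ xs) ys rewrite anyB-++ p xs ys with p x
  ... | true = refl
  ... | false = refl

  anyB-ʳ++ : ∀ {A : Set} (p : A → Bool) xs ys → anyB p (xs ʳ++ ys) ≡ anyB p xs ∨ anyB p ys
  anyB-ʳ++ p [] ys = refl
  anyB-ʳ++ p (x ∷ xs) ys rewrite anyB-ʳ++ p xs (x ∷ ys) with p x | anyB p xs
  ... | true | true = refl
  ... | true | false = refl
  ... | false | _ = refl

  allB-++ : ∀ {A : Set} (p : A → Bool) xs ys → allB p (xs ++ ys) ≡ allB p xs ∧ allB p ys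
  allB-++ p [] ys = refl
  allB-++ p (x ∷ xs) ys rewrite allB-++ p xs ys with p x
  ... | true = refl
  ... | false = refl

  anyB-cong : ∀ {A : Set} {p q : A → Bool} → (∀ x → p x ≡ q x) → ∀ xs → anyB p xs ≡ anyB q xs
  anyB-cong e [] = refl
  anyB-cong e (x ∷ xs) = cong₂ _∨_ (e x) (anyB-cong e xs)

  zip-++ : ∀ (as bs cs ds : List ℕ) → length as ≡ length bs → zip (as ++ cs) (bs ++ ds) ≡ zip as bs ++ zip cs ds
  zip-++ [] [] cs ds _ = refl
  zip-++ (a ∷ as) (b ∷ bs) cs ds e = cong ((a , b) ∷_) (zip-++ as bs cs ds (suc-injective e))

  ++-splitAt-length : ∀ (σ s₁ s₂ : List ℕ) → length (s₁ ++ s₂) ≡ length σ →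
    ∃₂ λ u v → σ ≡ u ++ v × length s₁ ≡ length u
  ++-splitAt-length σ [] s₂ _ = [] , σ , refl , refl
  ++-splitAt-length (x ∷ σ) (a ∷ s₁) s₂ e with ++-splitAt-length σ s₁ s₂ (suc-injective e)
  ... | u , v , refl , l = x ∷ u , v , refl , cong suc l

  ++-≡-++⁻ : ∀ (u v A B : List ℕ) → u ++ v ≡ A ++ B →
    (∃[ w ] (A ≡ u ++ w × v ≡ w ++ B)) ⊎ (∃[ w ] (u ≡ A ++ w × B ≡ w ++ v))
  ++-≡-++⁻ [] v A B e = inj₁ (A , refl , e)
  ++-≡-++⁻ (x ∷ u) v [] B e = inj₂ (x ∷ u , refl , sym e)
  ++-≡-++⁻ (x ∷ u) v (y ∷ A) B e with ∷-injectiveˡ e | ++-≡-++⁻ u v A B (∷-injectiveʳ e)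
  ... | refl | inj₁ (w , refl , v≡) = inj₁ (w , refl , v≡)
  ... | refl | inj₂ (w , refl , B≡) = inj₂ (w , refl , B≡)

  ∷-middle-injective : ∀ {x : ℕ} {α β α′ β′} → x ∉ α → x ∉ α′ → α ++ x ∷ β ≡ α′ ++ x ∷ β′ → α ≡ α′ × β ≡ β′
  ∷-middle-injective {α = []} {α′ = []} _ _ e = refl , ∷-injectiveʳ e
  ∷-middle-injective {α = []} {α′ = _ ∷ _} _ x∉α′ e = ⊥-elim (x∉α′ (here (∷-injectiveˡ e)))
  ∷-middle-injective {α = _ ∷ _} {α′ = []} x∉α _ e = ⊥-elim (x∉α (here (sym (∷-injectiveˡ e))))
  ∷-middle-injective {α = a ∷ α} {α′ = _ ∷ α′} x∉α x∉α′ e with ∷-injectiveˡ e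
  ... | refl with ∷-middle-injective (x∉α ∘ there) (x∉α′ ∘ there) (∷-injectiveʳ e)
  ... | refl , refl = refl , refl

  Unique-⊆ : ∀ {A : Set} {xs ys : List A} → xs ⊆ ys → Unique ys → Unique xs
  Unique-⊆ [] u = u
  Unique-⊆ (_ ∷ʳ xs⊆ys) (_ ∷ u) = Unique-⊆ xs⊆ys u
  Unique-⊆ (refl ∷ xs⊆ys) (y∉ys ∷ u) = All-resp-⊆ xs⊆ys y∉ys ∷ Unique-⊆ xs⊆ys u

  Unique-++-disjoint : ∀ {A : Set} xs {ys : List A} {x y} → Unique (xs ++ ys) → x ∈ xs → y ∈ ys → x ≢ y
  Unique-++-disjoint (_ ∷ xs) (x∉ ∷ _) (here refl) y∈ys = All.lookup (All.++⁻ʳ xs x∉) y∈ys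
  Unique-++-disjoint (_ ∷ xs) (_ ∷ u) (there x∈xs) y∈ys = Unique-++-disjoint xs u x∈xs y∈ys

  ∉-before : ∀ {x : ℕ} α {β} → Unique (α ++ x ∷ β) → x ∉ α
  ∉-before α u x∈α = Unique-++-disjoint α u x∈α (here refl) refl

  ∈-delete : ∀ {A : Set} {x y : A} xs ys → y ∈ xs ++ x ∷ ys → y ≢ x → y ∈ xs ++ ys
  ∈-delete [] ys (here y≡x) y≢x = contradiction y≡x y≢x
  ∈-delete [] ys (there y∈ys) _ = y∈ys
  ∈-delete (_ ∷ xs) ys (here y≡z) _ = here y≡z
  ∈-delete (_ ∷ xs) ys (there y∈) y≢x = there (∈-delete xs ys y∈ y≢x)

  unique-⊆-length : ∀ {A : Set} {xs : List A} ys → Unique xs → (∀ {x} → x ∈ xs → x ∈ ys) → length xs ≤ length ys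
  unique-⊆-length {xs = []} ys _ _ = z≤n
  unique-⊆-length {xs = x ∷ xs} ys (x∉xs ∷ u) xs⊆ys with ∈-∃++ (xs⊆ys (here refl))
  ... | ys₁ , ys₂ , refl = begin
    suc (length xs)             ≤⟨ s≤s (unique-⊆-length (ys₁ ++ ys₂) u xs⊆ys₁ys₂) ⟩
    suc (length (ys₁ ++ ys₂))   ≡⟨ cong suc (length-++ ys₁) ⟩
    suc (length ys₁ + length ys₂) ≡⟨ +-suc (length ys₁) (length ys₂) ⟨
    length ys₁ + suc (length ys₂) ≡⟨ length-++ ys₁ ⟨
    length (ys₁ ++ x ∷ ys₂)     ∎
    where
    open ≤-Reasoning
    xs⊆ys₁ys₂ : ∀ {y} → y ∈ xs → y ∈ ys₁ ++ ys₂
    xs⊆ys₁ys₂ y∈xs = ∈-delete ys₁ ys₂ (xs⊆ys (there y∈xs)) (λ y≡x → All.lookup x∉xs y∈xs (sym y≡x))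

  same-elements-length : ∀ {A : Set} {xs ys : List A} → Unique xs → Unique ys →
    (∀ {x} → x ∈ xs → x ∈ ys) → (∀ {x} → x ∈ ys → x ∈ xs) → length xs ≡ length ys
  same-elements-length {xs = xs} {ys} uxs uys xs⊆ys ys⊆xs =
    ≤-antisym (unique-⊆-length ys uxs xs⊆ys) (unique-⊆-length xs uys ys⊆xs)

  Unique-map-local : ∀ {A B : Set} (f : A → B) {xs} → (∀ {x y} → x ∈ xs → y ∈ xs → f x ≡ f y → x ≡ y) →
    Unique xs → Unique (map f xs)
  Unique-map-local f {[]} _ _ = []
  Unique-map-local f {x ∷ xs} inj (x∉ ∷ u) =
    All.map⁺ (All.tabulate (λ y∈ fx≡fy → All.lookup x∉ y∈ (inj (here refl) (there y∈) fx≡fy)))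
      ∷ Unique-map-local f (λ x∈ y∈ → inj (there x∈) (there y∈)) u

  Unique-concatMap : ∀ {A B : Set} (f : A → List B) {xs} → Unique xs → (∀ {x} → x ∈ xs → Unique (f x)) →
    (∀ {x y z} → x ∈ xs → y ∈ xs → z ∈ f x → z ∈ f y → x ≡ y) → Unique (concatMap f xs)
  Unique-concatMap f {[]} _ _ _ = []
  Unique-concatMap f {x ∷ xs} (x∉xs ∷ u) uf same =
    Unique.++⁺ (uf (here refl)) (Unique-concatMap f u (uf ∘ there) (λ x∈ y∈ → same (there x∈) (there y∈)))
      (λ (z∈fx , z∈rest) → let (y , y∈xs , z∈fy) = find (∈-concatMap⁻ f {xs = xs} z∈rest) in
         All.lookup x∉xs y∈xs (same (here refl) (there y∈xs) z∈fx z∈fy))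

  filterᵇ-filterᵇ : ∀ {A : Set} (p q : A → Bool) xs → filterᵇ q (filterᵇ p xs) ≡ filterᵇ (λ x → p x ∧ q x) xs
  filterᵇ-filterᵇ p q [] = refl
  filterᵇ-filterᵇ p q (x ∷ xs) with p x
  ... | false = filterᵇ-filterᵇ p q xs
  ... | true with q x
  ...   | false = filterᵇ-filterᵇ p q xs
  ...   | true = cong (x ∷_) (filterᵇ-filterᵇ p q xs)

  filterᵇ-cong : ∀ {A : Set} {p q : A → Bool} xs → (∀ {x} → x ∈ xs → p x ≡ q x) → filterᵇ p xs ≡ filterᵇ q xs
  filterᵇ-cong [] _ = refl
  filterᵇ-cong {p = p} {q} (x ∷ xs) p≗q with p x | q x | p≗q (here refl)
  ... | false | false | _ = filterᵇ-cong xs (p≗q ∘ there)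
  ... | true | true | _ = cong (x ∷_) (filterᵇ-cong xs (p≗q ∘ there))

  length-filterᵇ-++ : ∀ {A : Set} (p : A → Bool) xs ys → length (filterᵇ p (xs ++ ys)) ≡ length (filterᵇ p xs) + length (filterᵇ p ys)
  length-filterᵇ-++ p xs ys = trans (cong length (filter-++ (T? ∘ p) xs ys)) (length-++ (filterᵇ p xs))

  length-filterᵇ-map : ∀ {A B : Set} (p : B → Bool) (f : A → B) xs → length (filterᵇ p (map f xs)) ≡ length (filterᵇ (p ∘ f) xs)
  length-filterᵇ-map p f [] = refl
  length-filterᵇ-map p f (x ∷ xs) with p (f x)
  ... | false = length-filterᵇ-map p f xs
  ... | true = cong suc (length-filterᵇ-map p f xs)

  length-filterᵇ-concatMap : ∀ {A B : Set} (p : B → Bool) (F : A → List B) xs →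
    length (filterᵇ p (concatMap F xs)) ≡ sum (map (λ x → length (filterᵇ p (F x))) xs)
  length-filterᵇ-concatMap p F [] = refl
  length-filterᵇ-concatMap p F (x ∷ xs) =
    trans (length-filterᵇ-++ p (F x) (concatMap F xs)) (cong (length (filterᵇ p (F x)) +_) (length-filterᵇ-concatMap p F xs))

  length-filterᵇ-split : ∀ {A : Set} (q p : A → Bool) xs →
    length (filterᵇ p xs) ≡ length (filterᵇ (λ x → q x ∧ p x) xs) + length (filterᵇ (λ x → not (q x) ∧ p x) xs)
  length-filterᵇ-split q p [] = refl
  length-filterᵇ-split q p (x ∷ xs) with q x | p x
  ... | true | false = length-filterᵇ-split q p xs
  ... | false | false = length-filterᵇ-split q p xs
  ... | true | true = cong suc (length-filterᵇ-split q p xs)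
  ... | false | true = trans (cong suc (length-filterᵇ-split q p xs)) (sym (+-suc _ _))

  length-filterᵇ-cartesianProduct : ∀ {A B : Set} (p : A → Bool) (q : B → Bool) xs ys →
    length (filterᵇ (λ z → p (proj₁ z) ∧ q (proj₂ z)) (cartesianProduct xs ys)) ≡ length (filterᵇ p xs) * length (filterᵇ q ys)
  length-filterᵇ-cartesianProduct p q [] ys = refl
  length-filterᵇ-cartesianProduct p q (x ∷ xs) ys with p x in px
  ... | true = trans (length-filterᵇ-++ _ (map (x ,_) ys) (cartesianProduct xs ys))
    (cong₂ _+_ (trans (length-filterᵇ-map _ (x ,_) ys) (cong length (filterᵇ-cong ys (λ _ → cong (_∧ _) px))))
               (length-filterᵇ-cartesianProduct p q xs ys))
  ... | false = trans (length-filterᵇ-++ _ (map (x ,_) ys) (cartesianProduct xs ys))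
    (cong₂ _+_ (trans (length-filterᵇ-map _ (x ,_) ys) (trans (cong length (filterᵇ-cong ys (λ _ → cong (_∧ _) px))) (length-none ys)))
               (length-filterᵇ-cartesianProduct p q xs ys))
    where
    length-none : ∀ {B : Set} (ys : List B) → length (filterᵇ (λ _ → false) ys) ≡ 0
    length-none [] = refl
    length-none (_ ∷ ys) = length-none ys

  length-filterᵇ-same-elements : ∀ {A : Set} (p : A → Bool) {xs ys : List A} → Unique xs → Unique ys →
    (∀ {x} → x ∈ xs → x ∈ ys) → (∀ {x} → x ∈ ys → x ∈ xs) → length (filterᵇ p xs) ≡ length (filterᵇ p ys)
  length-filterᵇ-same-elements p uxs uys xs⊆ys ys⊆xs =
    same-elements-length (Unique.filter⁺ (T? ∘ p) uxs) (Unique.filter⁺ (T? ∘ p) uys) (restrict xs⊆ys) (restrict ys⊆xs)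
    where
    restrict : ∀ {xs ys} → (∀ {x} → x ∈ xs → x ∈ ys) → ∀ {x} → x ∈ filterᵇ p xs → x ∈ filterᵇ p ys
    restrict ⊆ x∈ with ∈-filter⁻ (T? ∘ p) x∈
    ... | x∈xs , px = ∈-filter⁺ (T? ∘ p) (⊆ x∈xs) px

  ∈-upTo′⁺ : ∀ {i n} → i ≤ n → i ∈ upTo' n
  ∈-upTo′⁺ {n = zero} z≤n = here refl
  ∈-upTo′⁺ {n = suc n} i≤n+1 with m≤n⇒m<n∨m≡n i≤n+1
  ... | inj₁ i<n+1 = ∈-++⁺ˡ (∈-upTo′⁺ (≤-pred i<n+1))
  ... | inj₂ refl = ∈-++⁺ʳ (upTo' n) (here refl)

  ∈-upTo′⁻ : ∀ {i} n → i ∈ upTo' n → i ≤ n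
  ∈-upTo′⁻ zero (here refl) = z≤n
  ∈-upTo′⁻ (suc n) i∈ with ∈-++⁻ (upTo' n) i∈
  ... | inj₁ i∈′ = m≤n⇒m≤1+n (∈-upTo′⁻ n i∈′)
  ... | inj₂ (here refl) = ≤-refl

  Unique-upTo′ : ∀ n → Unique (upTo' n)
  Unique-upTo′ zero = [] ∷ []
  Unique-upTo′ (suc n) = Unique.++⁺ (Unique-upTo′ n) ([] ∷ []) λ { (i∈ , here refl) → <-irrefl refl (∈-upTo′⁻ n i∈) }

  -- Pattern containment

  ∈-subseqs⁺ : ∀ {s xs} → s ⊆ xs → s ∈ subseqs xs
  ∈-subseqs⁺ [] = here refl
  ∈-subseqs⁺ (refl ∷ s⊆xs) = ∈-++⁺ˡ (∈-map⁺ (_ ∷_) (∈-subseqs⁺ s⊆xs))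
  ∈-subseqs⁺ {xs = x ∷ xs} (x ∷ʳ s⊆xs) = ∈-++⁺ʳ (map (x ∷_) (subseqs xs)) (∈-subseqs⁺ s⊆xs)

  ∈-subseqs⁻ : ∀ {s} xs → s ∈ subseqs xs → s ⊆ xs
  ∈-subseqs⁻ [] (here refl) = []
  ∈-subseqs⁻ (x ∷ xs) s∈ with ∈-++⁻ (map (x ∷_) (subseqs xs)) s∈
  ... | inj₂ s∈′ = x ∷ʳ ∈-subseqs⁻ xs s∈′
  ... | inj₁ s∈′ with ∈-map⁻ (x ∷_) s∈′
  ... | _ , s∈″ , refl = refl ∷ ∈-subseqs⁻ xs s∈″

  ⊆-++⁻ : ∀ {A : Set} {s : List A} xs ys → s ⊆ xs ++ ys → ∃₂ λ s₁ s₂ → s ≡ s₁ ++ s₂ × s₁ ⊆ xs × s₂ ⊆ ys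
  ⊆-++⁻ [] ys s⊆ys = [] , _ , refl , [] , s⊆ys
  ⊆-++⁻ (x ∷ xs) ys (x ∷ʳ s⊆) with ⊆-++⁻ xs ys s⊆
  ... | s₁ , s₂ , refl , s₁⊆ , s₂⊆ = s₁ , s₂ , refl , x ∷ʳ s₁⊆ , s₂⊆
  ⊆-++⁻ (x ∷ xs) ys (refl ∷ s⊆) with ⊆-++⁻ xs ys s⊆
  ... | s₁ , s₂ , refl , s₁⊆ , s₂⊆ = x ∷ s₁ , s₂ , refl , refl ∷ s₁⊆ , s₂⊆

  ⊆-map⁻ : ∀ (f : ℕ → ℕ) {s xs} → s ⊆ map f xs → ∃[ s′ ] (s ≡ map f s′ × s′ ⊆ xs)
  ⊆-map⁻ f {xs = []} [] = [] , refl , []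
  ⊆-map⁻ f {xs = x ∷ xs} (_ ∷ʳ s⊆) with ⊆-map⁻ f s⊆
  ... | s′ , refl , s′⊆ = s′ , refl , x ∷ʳ s′⊆
  ⊆-map⁻ f {xs = x ∷ xs} (refl ∷ s⊆) with ⊆-map⁻ f s⊆
  ... | s′ , refl , s′⊆ = x ∷ s′ , refl , refl ∷ s′⊆

  ⊆-++ʳ : ∀ {A : Set} (xs ys : List A) → xs ⊆ xs ++ ys
  ⊆-++ʳ xs ys = Sublist.++⁺ʳ ys ⊆-refl

  ⊆-++ˡ : ∀ {A : Set} (xs ys : List A) → ys ⊆ xs ++ ys
  ⊆-++ˡ xs ys = Sublist.++⁺ˡ xs ⊆-refl

  contains⁺ : ∀ {s π σ} → s ⊆ π → sameOrder s σ ≡ true → contains π σ ≡ true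
  contains⁺ s⊆π s≅σ = anyB⁺ _ (∈-subseqs⁺ s⊆π) s≅σ

  contains⁻ : ∀ π σ → contains π σ ≡ true → ∃[ s ] (s ⊆ π × sameOrder s σ ≡ true)
  contains⁻ π σ e with anyB⁻ _ (subseqs π) e
  ... | s , s∈ , s≅σ = s , ∈-subseqs⁻ π s∈ , s≅σ

  contains-⊆ : ∀ {π π′} σ → π ⊆ π′ → contains π σ ≡ true → contains π′ σ ≡ true
  contains-⊆ {π} σ π⊆π′ e with contains⁻ π σ e
  ... | s , s⊆π , s≅σ = contains⁺ (⊆-trans s⊆π π⊆π′) s≅σ

  sameSide : ℕ → ℕ → ℕ × ℕ → Bool
  sameSide a b = λ p → ((a <ᵇ proj₁ p) ==ᵇ (b <ᵇ proj₂ p)) ∧ ((proj₁ p <ᵇ a) ==ᵇ (proj₂ p <ᵇ b))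

  sameOrder-length : ∀ s σ → sameOrder s σ ≡ true → length s ≡ length σ
  sameOrder-length [] [] _ = refl
  sameOrder-length (a ∷ s) (b ∷ σ) e = cong suc (sameOrder-length s σ (proj₂ (∧-true⁻ {allB (sameSide a b) (zip s σ)} e)))

  -- cross s₁ u s₂ v: every entry of s₂ compares with every entry of s₁ as the
  -- corresponding entries of v and u compare.
  cross : List ℕ → List ℕ → List ℕ → List ℕ → Bool
  cross (a ∷ s₁) (b ∷ u) s₂ v = allB (sameSide a b) (zip s₂ v) ∧ cross s₁ u s₂ v
  cross _ _ _ _ = true

  sameOrder-++ : ∀ s₁ u s₂ v → length s₁ ≡ length u →
    sameOrder (s₁ ++ s₂) (u ++ v) ≡ (sameOrder s₁ u ∧ sameOrder s₂ v) ∧ cross s₁ u s₂ v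
  sameOrder-++ [] [] s₂ v _ = sym (∧-identityʳ _)
  sameOrder-++ (a ∷ s₁) (b ∷ u) s₂ v e
    rewrite zip-++ s₁ u s₂ v (suc-injective e)
          | allB-++ (sameSide a b) (zip s₁ u) (zip s₂ v)
          | sameOrder-++ s₁ u s₂ v (suc-injective e)
    = shuffle (allB (sameSide a b) (zip s₁ u)) (allB (sameSide a b) (zip s₂ v)) (sameOrder s₁ u) (sameOrder s₂ v) (cross s₁ u s₂ v)
    where
    shuffle : ∀ x y s t c → (x ∧ y) ∧ ((s ∧ t) ∧ c) ≡ ((x ∧ s) ∧ t) ∧ (y ∧ c)
    shuffle false y s t c = refl
    shuffle true false false t c = refl
    shuffle true false true false c = refl
    shuffle true false true true false = refl
    shuffle true false true true true = refl
    shuffle true true s t c = refl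

  sameOrder-++⁻ : ∀ s₁ u s₂ v → length s₁ ≡ length u → sameOrder (s₁ ++ s₂) (u ++ v) ≡ true →
    sameOrder s₁ u ≡ true × sameOrder s₂ v ≡ true × cross s₁ u s₂ v ≡ true
  sameOrder-++⁻ s₁ u s₂ v l e with ∧-true⁻ (trans (sym (sameOrder-++ s₁ u s₂ v l)) e)
  ... | parts , c with ∧-true⁻ {sameOrder s₁ u} parts
  ... | s₁≅u , s₂≅v = s₁≅u , s₂≅v , c

  sameOrder-++⁺ : ∀ s₁ u s₂ v → length s₁ ≡ length u →
    sameOrder s₁ u ≡ true → sameOrder s₂ v ≡ true → cross s₁ u s₂ v ≡ true → sameOrder (s₁ ++ s₂) (u ++ v) ≡ true
  sameOrder-++⁺ s₁ u s₂ v l s₁≅u s₂≅v c = trans (sameOrder-++ s₁ u s₂ v l) (∧-true⁺ (∧-true⁺ s₁≅u s₂≅v) c)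

  data Side : Set where
    below above : Side

  Lies : Side → ℕ → ℕ → Set
  Lies below x a = x < a
  Lies above x a = a < x

  Lies-asym : ∀ s {x a} → Lies s x a → Lies s a x → ⊥
  Lies-asym below = <-asym
  Lies-asym above = <-asym

  -- Separated below P Q: P ++ Q is a skew sum (Q entirely below P);
  -- Separated above P Q: P ++ Q is a direct sum.
  Separated : Side → List ℕ → List ℕ → Set
  Separated s P Q = All (λ a → All (λ x → Lies s x a) Q) P

  Separated-⊆ : ∀ s {P Q P′ Q′} → P′ ⊆ P → Q′ ⊆ Q → Separated s P Q → Separated s P′ Q′
  Separated-⊆ s P′⊆P Q′⊆Q sep = All.map (All-resp-⊆ Q′⊆Q) (All-resp-⊆ P′⊆P sep)

  private
    ==ᵇ-true : ∀ {x y} → (x ==ᵇ y) ≡ true → x ≡ true → y ≡ true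
    ==ᵇ-true {y = true} _ _ = refl
    ==ᵇ-true {true} {false} () _
    ==ᵇ-true {false} {false} _ ()

    ==ᵇ-both : ∀ {x y} → x ≡ y → (x ==ᵇ y) ≡ true
    ==ᵇ-both {false} refl = refl
    ==ᵇ-both {true} refl = refl

  sameSide⁺ : ∀ s {a b p q} → Lies s p a → Lies s q b → sameSide a b (p , q) ≡ true
  sameSide⁺ below p<a q<b =
    ∧-true⁺ (==ᵇ-both (trans (<ᵇ-false p<a) (sym (<ᵇ-false q<b)))) (==ᵇ-both (trans (<ᵇ-true p<a) (sym (<ᵇ-true q<b))))
  sameSide⁺ above a<p b<q =
    ∧-true⁺ (==ᵇ-both (trans (<ᵇ-true a<p) (sym (<ᵇ-true b<q)))) (==ᵇ-both (trans (<ᵇ-false a<p) (sym (<ᵇ-false b<q))))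

  sameSide⁻ : ∀ s {a b p q} → sameSide a b (p , q) ≡ true → Lies s p a → Lies s q b
  sameSide⁻ below {a} {b} {p} {q} e p<a = <ᵇ-true⁻ (==ᵇ-true (proj₂ (∧-true⁻ {(a <ᵇ p) ==ᵇ (b <ᵇ q)} e)) (<ᵇ-true p<a))
  sameSide⁻ above e a<p = <ᵇ-true⁻ (==ᵇ-true (proj₁ (∧-true⁻ e)) (<ᵇ-true a<p))

  allB-sameSide⁺ : ∀ s {a b} s₂ v → All (λ p → Lies s p a) s₂ → All (λ q → Lies s q b) v →
    allB (sameSide a b) (zip s₂ v) ≡ true
  allB-sameSide⁺ s [] v _ _ = refl
  allB-sameSide⁺ s (p ∷ s₂) [] _ _ = refl
  allB-sameSide⁺ s (p ∷ s₂) (q ∷ v) (lp ∷ lps) (lq ∷ lqs) = ∧-true⁺ (sameSide⁺ s lp lq) (allB-sameSide⁺ s s₂ v lps lqs)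

  allB-sameSide⁻ : ∀ s {a b} s₂ v → length s₂ ≡ length v → allB (sameSide a b) (zip s₂ v) ≡ true →
    All (λ p → Lies s p a) s₂ → All (λ q → Lies s q b) v
  allB-sameSide⁻ s [] [] _ _ _ = []
  allB-sameSide⁻ s {a} {b} (p ∷ s₂) (q ∷ v) e all (lp ∷ lps) with ∧-true⁻ {sameSide a b (p , q)} all
  ... | pq , rest = sameSide⁻ s pq lp ∷ allB-sameSide⁻ s s₂ v (suc-injective e) rest lps

  cross⁺ : ∀ s s₁ u s₂ v → Separated s s₁ s₂ → Separated s u v → cross s₁ u s₂ v ≡ true
  cross⁺ s [] u s₂ v _ _ = refl
  cross⁺ s (a ∷ s₁) [] s₂ v _ _ = refl
  cross⁺ s (a ∷ s₁) (b ∷ u) s₂ v (la ∷ las) (lb ∷ lbs) = ∧-true⁺ (allB-sameSide⁺ s s₂ v la lb) (cross⁺ s s₁ u s₂ v las lbs)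

  cross⁻ : ∀ s s₁ u s₂ v → length s₁ ≡ length u → length s₂ ≡ length v → cross s₁ u s₂ v ≡ true →
    Separated s s₁ s₂ → Separated s u v
  cross⁻ s [] [] s₂ v _ _ _ _ = []
  cross⁻ s (a ∷ s₁) (b ∷ u) s₂ v e₁ e₂ c (la ∷ las) with ∧-true⁻ {allB (sameSide a b) (zip s₂ v)} c
  ... | ab , rest = allB-sameSide⁻ s s₂ v e₂ ab la ∷ cross⁻ s s₁ u s₂ v (suc-injective e₁) e₂ rest las

  contains-prefix : ∀ π S T → contains π (S ++ T) ≡ true → contains π S ≡ true
  contains-prefix π S T e with contains⁻ π (S ++ T) e
  ... | w , w⊆π , w≅ST with ++-splitAt-length w S T (sym (sameOrder-length w (S ++ T) w≅ST))
  ... | s₁ , s₂ , refl , l = contains⁺ (⊆-trans (⊆-++ʳ s₁ s₂) w⊆π) (proj₁ (sameOrder-++⁻ s₁ S s₂ T (sym l) w≅ST))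

  contains-suffix : ∀ π S T → contains π (S ++ T) ≡ true → contains π T ≡ true
  contains-suffix π S T e with contains⁻ π (S ++ T) e
  ... | w , w⊆π , w≅ST with ++-splitAt-length w S T (sym (sameOrder-length w (S ++ T) w≅ST))
  ... | s₁ , s₂ , refl , l = contains⁺ (⊆-trans (⊆-++ˡ s₁ s₂) w⊆π) (proj₁ (proj₂ (sameOrder-++⁻ s₁ S s₂ T (sym l) w≅ST)))

  contains-++⁻ : ∀ s P Q σ → Separated s P Q → contains (P ++ Q) σ ≡ true →
    ∃₂ λ u v → σ ≡ u ++ v × Separated s u v × contains P u ≡ true × contains Q v ≡ true
  contains-++⁻ s P Q σ sep e with contains⁻ (P ++ Q) σ e
  ... | w , w⊆ , w≅σ with ⊆-++⁻ P Q w⊆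
  ... | s₁ , s₂ , refl , s₁⊆P , s₂⊆Q with ++-splitAt-length σ s₁ s₂ (sameOrder-length (s₁ ++ s₂) σ w≅σ)
  ... | u , v , refl , l with sameOrder-++⁻ s₁ u s₂ v l w≅σ
  ... | s₁≅u , s₂≅v , c =
    u , v , refl ,
    cross⁻ s s₁ u s₂ v l (sameOrder-length s₂ v s₂≅v) c (Separated-⊆ s s₁⊆P s₂⊆Q sep) ,
    contains⁺ s₁⊆P s₁≅u , contains⁺ s₂⊆Q s₂≅v

  contains-++⁺ : ∀ s {P Q u v} → Separated s P Q → Separated s u v →
    contains P u ≡ true → contains Q v ≡ true → contains (P ++ Q) (u ++ v) ≡ true
  contains-++⁺ s {P} {Q} {u} {v} sep sep′ eu ev with contains⁻ P u eu | contains⁻ Q v ev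
  ... | s₁ , s₁⊆P , s₁≅u | s₂ , s₂⊆Q , s₂≅v =
    contains⁺ (Sublist.++⁺ s₁⊆P s₂⊆Q)
      (sameOrder-++⁺ s₁ u s₂ v (sameOrder-length s₁ u s₁≅u) s₁≅u s₂≅v (cross⁺ s s₁ u s₂ v (Separated-⊆ s s₁⊆P s₂⊆Q sep) sep′))

  contains-[x]⁻ : ∀ M v → contains (M ∷ []) v ≡ true → v ≡ [] ⊎ ∃[ z ] v ≡ z ∷ []
  contains-[x]⁻ M v e with contains⁻ (M ∷ []) v e
  ... | s , s⊆ , s≅v = short s⊆ (sameOrder-length s v s≅v)
    where
    short : ∀ {s v} → s ⊆ M ∷ [] → length s ≡ length v → v ≡ [] ⊎ ∃[ z ] v ≡ z ∷ []
    short {v = []} _ _ = inj₁ refl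
    short {v = z ∷ []} _ _ = inj₂ (z , refl)
    short {v = _ ∷ _ ∷ _} (_ ∷ʳ []) ()
    short {v = _ ∷ _ ∷ _} (refl ∷ []) ()

  contains-snoc⁻ : ∀ s X M σ z → All (λ x → Lies s M x) X → contains (X ++ M ∷ []) (σ ++ z ∷ []) ≡ true →
    contains X (σ ++ z ∷ []) ≡ true ⊎ (contains X σ ≡ true × All (λ y → Lies s z y) σ)
  contains-snoc⁻ s X M σ z M-side e with contains-++⁻ s X (M ∷ []) (σ ++ z ∷ []) (All.map (_∷ []) M-side) e
  ... | u , v , eq , sep , X⊇u , [M]⊇v with contains-[x]⁻ M v [M]⊇v
  ... | inj₁ refl rewrite ++-identityʳ u | eq = inj₁ X⊇u
  ... | inj₂ (_ , refl) with ∷ʳ-injective σ u eq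
  ... | refl , refl = inj₂ (X⊇u , All.map (λ { (z-side ∷ []) → z-side }) sep)

  contains-snoc-skip : ∀ s {X M σ z w} → All (λ x → Lies s M x) X → w ∈ σ → Lies s w z →
    contains (X ++ M ∷ []) (σ ++ z ∷ []) ≡ true → contains X (σ ++ z ∷ []) ≡ true
  contains-snoc-skip s {X} {M} {σ} {z} M-side w∈σ w-side e with contains-snoc⁻ s X M σ z M-side e
  ... | inj₁ c = c
  ... | inj₂ (_ , z-side) = ⊥-elim (Lies-asym s w-side (All.lookup z-side w∈σ))

  contains-snoc-extremes : ∀ s X M S K → All (λ x → Lies s M x) X → All (λ y → Lies s K y) S →
    contains (X ++ M ∷ []) (S ++ K ∷ []) ≡ contains X S
  contains-snoc-extremes s X M S K M-side K-side = true⇔true⇒≡ to from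
    where
    to : contains (X ++ M ∷ []) (S ++ K ∷ []) ≡ true → contains X S ≡ true
    to e with contains-snoc⁻ s X M S K M-side e
    ... | inj₁ c = contains-prefix X S (K ∷ []) c
    ... | inj₂ (c , _) = c
    from : contains X S ≡ true → contains (X ++ M ∷ []) (S ++ K ∷ []) ≡ true
    from e = contains-++⁺ s (All.map (_∷ []) M-side) (All.map (_∷ []) K-side) e refl

  contains-cons-max : ∀ {M β h σ w} → All (_< M) β → w ∈ σ → h < w →
    contains (M ∷ β) (h ∷ σ) ≡ contains β (h ∷ σ)
  contains-cons-max {M} {β} {h} {σ} β<M w∈σ h<w = true⇔true⇒≡ to (contains-⊆ {β} (h ∷ σ) (M ∷ʳ ⊆-refl))
    where
    to : contains (M ∷ β) (h ∷ σ) ≡ true → contains β (h ∷ σ) ≡ true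
    to e with contains-++⁻ below (M ∷ []) β (h ∷ σ) (β<M ∷ []) e
    ... | u , v , eq , sep , [M]⊇u , β⊇v with contains-[x]⁻ M u [M]⊇u
    ... | inj₁ refl rewrite eq = β⊇v
    ... | inj₂ (_ , refl) with eq | sep
    ... | refl | σ<h ∷ [] = ⊥-elim (<-asym h<w (All.lookup σ<h w∈σ))

  FrontMaxIrrelevant : List ℕ → Set
  FrontMaxIrrelevant σ = ∀ M β → All (_< M) β → contains (M ∷ β) σ ≡ contains β σ

  front-max-irrelevant : ∀ X y z rest → All (_< z) X → y < z → FrontMaxIrrelevant (X ++ y ∷ z ∷ rest)
  front-max-irrelevant [] y z rest _ y<z M β β<M = contains-cons-max β<M (here refl) y<z
  front-max-irrelevant (x ∷ X) y z rest (x<z ∷ _) _ M β β<M =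
    contains-cons-max β<M (∈-++⁺ʳ X (there (here refl))) x<z

  contains-[]-nonempty : ∀ X y rest → contains [] (X ++ y ∷ rest) ≡ false
  contains-[]-nonempty [] y rest = refl
  contains-[]-nonempty (x ∷ X) y rest = refl

  SkewIndecomposable : List ℕ → Set
  SkewIndecomposable L = ∀ X Y → X ++ Y ≡ L → Separated below X Y → X ≡ [] ⊎ Y ≡ []

  ends-with-max⇒indecomposable : ∀ L z → All (_< z) L → SkewIndecomposable (L ++ z ∷ [])
  ends-with-max⇒indecomposable L z L<z [] Y _ _ = inj₁ refl
  ends-with-max⇒indecomposable L z L<z (x ∷ X) Y e sep with initLast Y
  ... | [] = inj₂ refl
  ... | Y′ ∷ʳ′ y with ∷ʳ-injective ((x ∷ X) ++ Y′) L (trans (++-assoc (x ∷ X) Y′ (y ∷ [])) e)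
  ...   | x∷X++Y′≡L , refl = ⊥-elim (<-asym (All.lookup (All.head sep) (∈-++⁺ʳ Y′ (here refl)))
                                            (All.lookup L<z (subst (x ∈_) x∷X++Y′≡L (here refl))))

  skew-splittings : ∀ A B → SkewIndecomposable A → SkewIndecomposable B → ∀ u v → u ++ v ≡ A ++ B →
    Separated below u v → (u ≡ [] × v ≡ A ++ B) ⊎ (u ≡ A × v ≡ B) ⊎ (u ≡ A ++ B × v ≡ [])
  skew-splittings A B A-indec B-indec u v e sep with ++-≡-++⁻ u v A B e
  ... | inj₁ (w , refl , refl) with A-indec u w refl (Separated-⊆ below ⊆-refl (⊆-++ʳ w B) sep)
  ...   | inj₁ refl = inj₁ (refl , refl)
  ...   | inj₂ refl = inj₂ (inj₁ (sym (++-identityʳ u) , refl))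
  skew-splittings A B A-indec B-indec u v e sep | inj₂ (w , refl , refl)
    with B-indec w v refl (Separated-⊆ below (⊆-++ˡ A w) ⊆-refl sep)
  ...   | inj₁ refl = inj₂ (inj₁ (++-identityʳ A , refl))
  ...   | inj₂ refl = inj₂ (inj₂ (cong (A ++_) (sym (++-identityʳ w)) , refl))

  sameOrder-comm : ∀ s σ → sameOrder s σ ≡ sameOrder σ s
  sameOrder-comm [] [] = refl
  sameOrder-comm [] (_ ∷ _) = refl
  sameOrder-comm (_ ∷ _) [] = refl
  sameOrder-comm (a ∷ s) (b ∷ σ) = cong₂ _∧_ (allB-swap s σ) (sameOrder-comm s σ)
    where
    ==ᵇ-comm : ∀ x y → (x ==ᵇ y) ≡ (y ==ᵇ x)
    ==ᵇ-comm x y = cong not (xor-comm x y)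
    allB-swap : ∀ s σ → allB (sameSide a b) (zip s σ) ≡ allB (sameSide b a) (zip σ s)
    allB-swap [] [] = refl
    allB-swap [] (_ ∷ _) = refl
    allB-swap (_ ∷ _) [] = refl
    allB-swap (p ∷ s) (q ∷ σ) =
      cong₂ _∧_ (cong₂ _∧_ (==ᵇ-comm (a <ᵇ p) (b <ᵇ q)) (==ᵇ-comm (p <ᵇ a) (q <ᵇ b))) (allB-swap s σ)

  OrderPreservingOn : (ℕ → Set) → (ℕ → ℕ) → Set
  OrderPreservingOn P f = ∀ a b → P a → P b → (f a <ᵇ f b) ≡ (a <ᵇ b)

  module _ {P : ℕ → Set} {f : ℕ → ℕ} (pres : OrderPreservingOn P f) where

    sameOrder-mapˡ : ∀ s σ → All P s → sameOrder (map f s) σ ≡ sameOrder s σ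
    sameOrder-mapˡ [] [] _ = refl
    sameOrder-mapˡ [] (_ ∷ _) _ = refl
    sameOrder-mapˡ (_ ∷ _) [] _ = refl
    sameOrder-mapˡ (a ∷ s) (b ∷ σ) (pa ∷ ps) = cong₂ _∧_ (allB-mapˡ s σ ps) (sameOrder-mapˡ s σ ps)
      where
      allB-mapˡ : ∀ as bs → All P as → allB (sameSide (f a) b) (zip (map f as) bs) ≡ allB (sameSide a b) (zip as bs)
      allB-mapˡ [] bs _ = refl
      allB-mapˡ (_ ∷ _) [] _ = refl
      allB-mapˡ (x ∷ as) (y ∷ bs) (px ∷ pxs) rewrite pres a x pa px | pres x a px pa = cong (_ ∧_) (allB-mapˡ as bs pxs)

    sameOrder-mapʳ : ∀ s σ → All P σ → sameOrder s (map f σ) ≡ sameOrder s σ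
    sameOrder-mapʳ s σ pσ = trans (sameOrder-comm s (map f σ)) (trans (sameOrder-mapˡ σ s pσ) (sameOrder-comm σ s))

    contains-mapʳ : ∀ π σ → All P σ → contains π (map f σ) ≡ contains π σ
    contains-mapʳ π σ pσ = anyB-cong (λ s → sameOrder-mapʳ s σ pσ) (subseqs π)

    contains-mapˡ : ∀ π σ → All P π → contains (map f π) σ ≡ contains π σ
    contains-mapˡ π σ pπ = true⇔true⇒≡ to from
      where
      to : contains (map f π) σ ≡ true → contains π σ ≡ true
      to e with contains⁻ (map f π) σ e
      ... | s , s⊆ , s≅σ with ⊆-map⁻ f s⊆
      ... | s′ , refl , s′⊆π = contains⁺ s′⊆π (trans (sym (sameOrder-mapˡ s′ σ (All-resp-⊆ s′⊆π pπ))) s≅σ)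
      from : contains π σ ≡ true → contains (map f π) σ ≡ true
      from e with contains⁻ π σ e
      ... | s , s⊆π , s≅σ = contains⁺ (Sublist.map⁺ f s⊆π) (trans (sameOrder-mapˡ s σ (All-resp-⊆ s⊆π pπ)) s≅σ)

  shift-orderPreserving : ∀ c → OrderPreservingOn (λ _ → ⊤) (_+ c)
  shift-orderPreserving c a b _ _ = +-<ᵇ c a b

  contains-shift : ∀ c π σ → contains (map (_+ c) π) σ ≡ contains π σ
  contains-shift c π σ = contains-mapˡ (shift-orderPreserving c) π σ (All.universal (λ _ → tt) π)

  ∸-orderPreserving : ∀ c → OrderPreservingOn (c ≤_) (_∸ c)
  ∸-orderPreserving c a b c≤a c≤b = true⇔true⇒≡
    (λ e → <ᵇ-true (subst₂ _<_ (m∸n+n≡m c≤a) (m∸n+n≡m c≤b) (+-monoˡ-< c (<ᵇ-true⁻ {a ∸ c} {b ∸ c} e))))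
    (λ e → <ᵇ-true (∸-monoˡ-< (<ᵇ-true⁻ {a} {b} e) c≤a))

  contains-lower : ∀ c π σ → All (c ≤_) σ → contains π (map (_∸ c) σ) ≡ contains π σ
  contains-lower c = contains-mapʳ (∸-orderPreserving c)

  Between : ℕ → ℕ → ℕ → Set
  Between lo hi x = lo < x × x ≤ hi

  unique-between-length : ∀ {lo hi xs} → Unique xs → All (Between lo hi) xs → length xs ≤ hi ∸ lo
  unique-between-length {lo} {hi} {xs} u bounds =
    subst (length xs ≤_) (length-applyUpTo (suc lo +_) (hi ∸ lo))
      (unique-⊆-length _ u (λ x∈xs → in-range (All.lookup bounds x∈xs)))
    where
    in-range : ∀ {x} → Between lo hi x → x ∈ applyUpTo (suc lo +_) (hi ∸ lo)
    in-range (lo<x , x≤hi) = subst (_∈ _) (m+[n∸m]≡n lo<x) (∈-applyUpTo⁺ (suc lo +_) (∸-monoˡ-< (s≤s x≤hi) lo<x))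

  record IsPerm (n : ℕ) (π : List ℕ) : Set where
    constructor isPerm
    field
      unique : Unique π
      length≡ : length π ≡ n
      bounded : All (Between 0 n) π

  open IsPerm

  inserts-∈ : ∀ x α β → α ++ x ∷ β ∈ inserts x (α ++ β)
  inserts-∈ x [] [] = here refl
  inserts-∈ x [] (_ ∷ _) = here refl
  inserts-∈ x (a ∷ α) β = there (∈-map⁺ (a ∷_) (inserts-∈ x α β))

  ∈-inserts⁻ : ∀ x σ {π} → π ∈ inserts x σ → ∃₂ λ α β → σ ≡ α ++ β × π ≡ α ++ x ∷ β
  ∈-inserts⁻ x [] (here refl) = [] , [] , refl , refl
  ∈-inserts⁻ x (y ∷ σ) (here refl) = [] , y ∷ σ , refl , refl
  ∈-inserts⁻ x (y ∷ σ) (there π∈) with ∈-map⁻ (y ∷_) π∈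
  ... | _ , π′∈ , refl with ∈-inserts⁻ x σ π′∈
  ... | α , β , refl , refl = y ∷ α , β , refl , refl

  insert-max : ∀ n α β → α ++ β ∈ perms n → α ++ suc n ∷ β ∈ perms (suc n)
  insert-max n α β σ∈ = ∈-concatMap⁺ (inserts (suc n)) (lose σ∈ (inserts-∈ (suc n) α β))

  ∈-perms-suc⁻ : ∀ n {π} → π ∈ perms (suc n) → ∃[ σ ] (σ ∈ perms n × π ∈ inserts (suc n) σ)
  ∈-perms-suc⁻ n π∈ = find (∈-concatMap⁻ (inserts (suc n)) {xs = perms n} π∈)

  perms⇒IsPerm : ∀ n {π} → π ∈ perms n → IsPerm n π
  perms⇒IsPerm zero (here refl) = isPerm [] refl []
  perms⇒IsPerm (suc n) π∈ with ∈-perms-suc⁻ n π∈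
  ... | σ , σ∈ , π∈ins with ∈-inserts⁻ (suc n) σ π∈ins | perms⇒IsPerm n σ∈
  ... | α , β , refl , refl | isPerm u l b = isPerm
    (unique-insert α β (All.map (λ { (_ , x≤n) x≡ → <-irrefl (sym x≡) (s≤s x≤n) }) b) u)
    (trans (length-++ α) (trans (+-suc (length α) (length β)) (cong suc (trans (sym (length-++ α)) l))))
    (All.++⁺ (All.++⁻ˡ α b′) ((z<s , ≤-refl) ∷ All.++⁻ʳ α b′))
    where
    b′ = All.map (λ { (0<x , x≤n) → 0<x , m≤n⇒m≤1+n x≤n }) b
    unique-insert : ∀ {x} α β → All (x ≢_) (α ++ β) → Unique (α ++ β) → Unique (α ++ x ∷ β)
    unique-insert [] β x∉ u = x∉ ∷ u
    unique-insert (a ∷ α) β (x≢a ∷ x∉) (a∉ ∷ u) =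
      All.++⁺ (All.++⁻ˡ α a∉) ((λ a≡x → x≢a (sym a≡x)) ∷ All.++⁻ʳ α a∉) ∷ unique-insert α β x∉ u

  max∈perm : ∀ {n π} → IsPerm (suc n) π → suc n ∈ π
  max∈perm {n} {π} (isPerm u l b) with suc n ∈? π
  ... | yes n+1∈π = n+1∈π
  ... | no n+1∉π = contradiction (subst (_≤ n) l (unique-between-length u (All.tabulate below-max))) (<-irrefl refl)
    where
    below-max : ∀ {x} → x ∈ π → Between 0 n x
    below-max x∈π with All.lookup b x∈π
    ... | 0<x , x≤n+1 = 0<x , ≤-pred (≤∧≢⇒< x≤n+1 (λ x≡ → n+1∉π (subst (_∈ π) x≡ x∈π)))

  remove-max : ∀ {n} α β → IsPerm (suc n) (α ++ suc n ∷ β) → IsPerm n (α ++ β)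
  remove-max {n} α β (isPerm u l b) = isPerm
    (Unique-⊆ α++β⊆ u)
    (suc-injective (begin
      suc (length (α ++ β))       ≡⟨ cong suc (length-++ α) ⟩
      suc (length α + length β)   ≡⟨ +-suc (length α) (length β) ⟨
      length α + length (suc n ∷ β) ≡⟨ length-++ α ⟨
      length (α ++ suc n ∷ β)     ≡⟨ l ⟩
      suc n                       ∎))
    (All.tabulate bound)
    where
    open ≡-Reasoning
    α++β⊆ : α ++ β ⊆ α ++ suc n ∷ β
    α++β⊆ = Sublist.++⁺ ⊆-refl (suc n ∷ʳ ⊆-refl)
    n+1∉ : ∀ {x} → x ∈ α ++ β → x ≢ suc n
    n+1∉ {x} x∈ x≡ = ∉-middle α β u (subst (_∈ α ++ β) x≡ x∈)
      where
      ∉-middle : ∀ α β → Unique (α ++ suc n ∷ β) → suc n ∉ α ++ β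
      ∉-middle [] β (n+1∉β ∷ _) n+1∈β = All.lookup n+1∉β n+1∈β refl
      ∉-middle (a ∷ α) β (a∉ ∷ u) (here refl) = All.lookup a∉ (∈-++⁺ʳ α (here refl)) refl
      ∉-middle (a ∷ α) β (_ ∷ u) (there n+1∈) = ∉-middle α β u n+1∈
    bound : ∀ {x} → x ∈ α ++ β → Between 0 n x
    bound x∈ with All.lookup (All-resp-⊆ α++β⊆ b) x∈
    ... | 0<x , x≤n+1 = 0<x , ≤-pred (≤∧≢⇒< x≤n+1 (n+1∉ x∈))

  IsPerm⇒perms : ∀ n {π} → IsPerm n π → π ∈ perms n
  IsPerm⇒perms zero {[]} _ = here refl
  IsPerm⇒perms zero {_ ∷ _} (isPerm _ () _)
  IsPerm⇒perms (suc n) {π} p with ∈-∃++ (max∈perm p)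
  ... | α , β , refl = insert-max n α β (IsPerm⇒perms n (remove-max α β p))

  unique-perms : ∀ n → Unique (perms n)
  unique-perms zero = [] ∷ []
  unique-perms (suc n) = Unique-concatMap (inserts (suc n)) (unique-perms n)
    (λ σ∈ → unique-inserts _ (n+1∉ σ∈)) inserts-disjoint
    where
    n+1∉ : ∀ {σ} → σ ∈ perms n → suc n ∉ σ
    n+1∉ σ∈ n+1∈ = <-irrefl refl (proj₂ (All.lookup (bounded (perms⇒IsPerm n σ∈)) n+1∈))
    unique-inserts : ∀ {x} σ → x ∉ σ → Unique (inserts x σ)
    unique-inserts [] _ = [] ∷ []
    unique-inserts {x} (y ∷ σ) x∉ =
      All.tabulate (λ π∈ e → let (_ , _ , π≡) = ∈-map⁻ (y ∷_) π∈ in x∉ (here (∷-injectiveˡ (trans e π≡)))) ∷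
      Unique.map⁺ ∷-injectiveʳ (unique-inserts σ (x∉ ∘ there))
    inserts-disjoint : ∀ {σ σ′ π} → σ ∈ perms n → σ′ ∈ perms n →
      π ∈ inserts (suc n) σ → π ∈ inserts (suc n) σ′ → σ ≡ σ′
    inserts-disjoint {σ} {σ′} σ∈ σ′∈ π∈ π∈′ with ∈-inserts⁻ (suc n) σ π∈ | ∈-inserts⁻ (suc n) σ′ π∈′
    ... | α , β , refl , refl | α′ , β′ , refl , e
      with ∷-middle-injective (n+1∉ σ∈ ∘ ∈-++⁺ˡ) (n+1∉ σ′∈ ∘ ∈-++⁺ˡ) e
    ... | refl , refl = refl

  skew-perm : ∀ {i j xs ys} → IsPerm i xs → IsPerm j ys → IsPerm (i + j) (map (_+ j) xs ++ ys)
  skew-perm {i} {j} {xs} {ys} (isPerm uxs lxs bxs) (isPerm uys lys bys) = isPerm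
    (Unique.++⁺ (Unique.map⁺ (+-cancelʳ-≡ j _ _) uxs) uys disjoint)
    (trans (length-++ (map (_+ j) xs)) (cong₂ _+_ (trans (length-map _ xs) lxs) lys))
    (All.++⁺ (All.map⁺ (All.map shift bxs)) (All.map widen bys))
    where
    disjoint : ∀ {v} → ¬ (v ∈ map (_+ j) xs × v ∈ ys)
    disjoint (v∈ , v∈ys) with ∈-map⁻ (_+ j) v∈
    ... | x , x∈xs , refl = <-irrefl refl (<-≤-trans (m<n+m j (proj₁ (All.lookup bxs x∈xs))) (proj₂ (All.lookup bys v∈ys)))
    shift : ∀ {x} → Between 0 i x → Between 0 (i + j) (x + j)
    shift {x} (0<x , x≤i) = <-≤-trans 0<x (m≤m+n x j) , +-monoˡ-≤ j x≤i
    widen : ∀ {y} → Between 0 j y → Between 0 (i + j) y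
    widen (0<y , y≤j) = 0<y , ≤-trans y≤j (m≤n+m j i)

  skew-split : ∀ {n} xs ys → IsPerm n (xs ++ ys) → Separated below xs ys →
    IsPerm (length ys) ys × ∃[ xs′ ] (xs ≡ map (_+ length ys) xs′ × IsPerm (length xs) xs′)
  skew-split {n} xs ys (isPerm u l b) sep =
    isPerm uys refl (All.tabulate ys-bound) ,
    map (_∸ j) xs , sym shift-back ,
    isPerm (Unique.map⁻ (subst Unique (sym shift-back) uxs)) (length-map _ xs) (All.map⁺ (All.tabulate xs′-bound))
    where
    i = length xs
    j = length ys
    i+j≡n : i + j ≡ n
    i+j≡n = trans (sym (length-++ xs)) l
    uxs = Unique-⊆ (⊆-++ʳ xs ys) u
    uys = Unique-⊆ (⊆-++ˡ xs ys) u
    bxs = All.++⁻ˡ xs b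
    bys = All.++⁻ʳ xs b
    ys-bound : ∀ {y} → y ∈ ys → Between 0 j y
    ys-bound {y} y∈ys = proj₁ (All.lookup bys y∈ys) , +-cancelˡ-≤ i y j (subst (i + y ≤_) (sym i+j≡n) i+y≤n)
      where
      y≤n = proj₂ (All.lookup bys y∈ys)
      -- the i entries of xs are distinct and lie in (y, n]
      i+y≤n : i + y ≤ n
      i+y≤n = m≤o∸n⇒m+n≤o i y≤n (unique-between-length uxs
        (All.tabulate (λ x∈xs → All.lookup (All.lookup sep x∈xs) y∈ys , proj₂ (All.lookup bxs x∈xs))))
    -- x and the j entries of ys are distinct and lie in (0, x]
    j<x : ∀ {x} → x ∈ xs → j < x
    j<x {x} x∈xs = unique-between-length {0} {x} {x ∷ ys}
      (All.tabulate (λ y∈ys x≡y → <-irrefl (sym x≡y) (All.lookup (All.lookup sep x∈xs) y∈ys)) ∷ uys)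
      ((proj₁ (All.lookup bxs x∈xs) , ≤-refl) ∷
       All.tabulate (λ y∈ys → proj₁ (All.lookup bys y∈ys) , <⇒≤ (All.lookup (All.lookup sep x∈xs) y∈ys)))
    xs′-bound : ∀ {x} → x ∈ xs → Between 0 i (x ∸ j)
    xs′-bound {x} x∈xs = m<n⇒0<n∸m (j<x x∈xs) ,
      m≤n+o⇒m∸n≤o x j (subst (x ≤_) (trans (sym i+j≡n) (+-comm i j)) (proj₂ (All.lookup bxs x∈xs)))
    shift-back : map (_+ j) (map (_∸ j) xs) ≡ xs
    shift-back = trans (sym (map-∘ xs)) (map-id-local (All.tabulate (λ x∈xs → m∸n+n≡m (<⇒≤ (j<x x∈xs)))))

  max-first-perm : ∀ {j m β} → IsPerm (suc j) (m ∷ β) → All (_< m) β → m ≡ suc j × IsPerm j β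
  max-first-perm {j} {m} {β} p β<m with max∈perm p
  ... | here refl = refl , remove-max [] β p
  ... | there j+1∈β = contradiction m≤j+1 (<⇒≱ (All.lookup β<m j+1∈β))
    where
    m≤j+1 : m ≤ suc j
    m≤j+1 = proj₂ (All.lookup (bounded p) (here refl))

  perm-below-max : ∀ {n β} → β ∈ perms n → All (_< suc n) β
  perm-below-max {n} β∈ = All.map (λ (_ , x≤n) → s≤s x≤n) (bounded (perms⇒IsPerm n β∈))

  -- Motzkin permutations

  noVinc-++ : ∀ pre xs y ys → noVinc pre (xs ++ y ∷ ys) ≡ noVinc pre (xs ++ y ∷ []) ∧ noVinc (xs ʳ++ pre) (y ∷ ys)
  noVinc-++ pre [] y ys = refl
  noVinc-++ pre (x ∷ []) y ys = cong (_∧ noVinc (x ∷ pre) (y ∷ ys)) (sym (∧-identityʳ _))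
  noVinc-++ pre (x ∷ x′ ∷ xs) y ys rewrite noVinc-++ (x ∷ pre) (x′ ∷ xs) y ys =
    sym (∧-assoc (not ((x <ᵇ x′) ∧ anyB (λ a → a <ᵇ x) pre)) _ _)

  noVinc-prefix : ∀ pre xs ys → noVinc pre (xs ++ ys) ≡ true → noVinc pre xs ≡ true
  noVinc-prefix pre [] ys _ = refl
  noVinc-prefix pre (x ∷ []) ys _ = refl
  noVinc-prefix pre (x ∷ x′ ∷ xs) ys e =
    ∧-true⁺ (proj₁ split) (noVinc-prefix (x ∷ pre) (x′ ∷ xs) ys (proj₂ split))
    where split = ∧-true⁻ {not ((x <ᵇ x′) ∧ anyB (λ a → a <ᵇ x) pre)} e

  NoneBelow : List ℕ → List ℕ → Set
  NoneBelow pre ys = All (λ y → anyB (λ a → a <ᵇ y) pre ≡ false) ys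

  noVinc-drop : ∀ pre P rest → NoneBelow P rest → noVinc (pre ++ P) rest ≡ noVinc pre rest
  noVinc-drop pre P [] _ = refl
  noVinc-drop pre P (x ∷ []) _ = refl
  noVinc-drop pre P (x ∷ y ∷ r) (none ∷ nones)
    rewrite anyB-++ (λ a → a <ᵇ x) pre P | none | ∨-identityʳ (anyB (λ a → a <ᵇ x) pre)
    = cong (not ((x <ᵇ y) ∧ anyB (λ a → a <ᵇ x) pre) ∧_) (noVinc-drop (x ∷ pre) P (y ∷ r) nones)

  noVinc-max-first : ∀ P M β → All (_< M) β → NoneBelow P β → noVinc P (M ∷ β) ≡ noVinc [] β
  noVinc-max-first P M [] _ _ = refl
  noVinc-max-first P M (b ∷ β) (b<M ∷ β<M) nones rewrite <ᵇ-false {M} {b} b<M =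
    noVinc-drop [] (M ∷ P) (b ∷ β) (M∷P-none (b<M ∷ β<M) nones)
    where
    M∷P-none : ∀ {xs} → All (_< M) xs → NoneBelow P xs → NoneBelow (M ∷ P) xs
    M∷P-none [] [] = []
    M∷P-none (x<M ∷ xs<M) (none ∷ nones) = cong₂ _∨_ (<ᵇ-false x<M) none ∷ M∷P-none xs<M nones

  noVinc-snoc-min : ∀ pre xs y → All (y <_) xs → noVinc pre (xs ++ y ∷ []) ≡ noVinc pre xs
  noVinc-snoc-min pre [] y _ = refl
  noVinc-snoc-min pre (x ∷ []) y (y<x ∷ []) rewrite <ᵇ-false {x} {y} y<x = refl
  noVinc-snoc-min pre (x ∷ x′ ∷ xs) y (_ ∷ y<xs) =
    cong (not ((x <ᵇ x′) ∧ anyB (λ a → a <ᵇ x) pre) ∧_) (noVinc-snoc-min (x ∷ pre) (x′ ∷ xs) y y<xs)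

  noVinc-map : ∀ (f : ℕ → ℕ) → (∀ a b → (f a <ᵇ f b) ≡ (a <ᵇ b)) → ∀ pre rest →
    noVinc (map f pre) (map f rest) ≡ noVinc pre rest
  noVinc-map f pres pre [] = refl
  noVinc-map f pres pre (x ∷ []) = refl
  noVinc-map f pres pre (x ∷ y ∷ r) =
    cong₂ (λ a b → not a ∧ b) (cong₂ _∧_ (pres x y) (anyB-map pre)) (noVinc-map f pres (x ∷ pre) (y ∷ r))
    where
    anyB-map : ∀ pre → anyB (λ a → a <ᵇ f x) (map f pre) ≡ anyB (λ a → a <ᵇ x) pre
    anyB-map [] = refl
    anyB-map (p ∷ pre) = cong₂ _∨_ (pres p x) (anyB-map pre)

  noneBelow⁺ : ∀ xs ys → Separated below xs ys → NoneBelow (xs ʳ++ []) ys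
  noneBelow⁺ xs ys sep = All.tabulate λ {y} y∈ys →
    trans (anyB-ʳ++ (λ a → a <ᵇ y) xs [])
      (trans (∨-identityʳ _) (anyB-false⁺ _ (All.map (λ ys<a → <ᵇ-false (All.lookup ys<a y∈ys)) sep)))

  noVinc-pair : ∀ pre y z → anyB (λ a → a <ᵇ y) pre ≡ false → noVinc pre (y ∷ z ∷ []) ≡ true
  noVinc-pair pre y z none rewrite none | ∧-zeroʳ (y <ᵇ z) = refl

  p132 : List ℕ
  p132 = 1 ∷ 3 ∷ 2 ∷ []

  isMotzkin⁺ : ∀ π → contains π p132 ≡ false → noVinc [] π ≡ true → isMotzkin π ≡ true
  isMotzkin⁺ π c v rewrite c | v = refl

  isMotzkin⁻ : ∀ π → isMotzkin π ≡ true → contains π p132 ≡ false × noVinc [] π ≡ true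
  isMotzkin⁻ π e with ∧-true⁻ e
  ... | avoids , v = not-true⁻ avoids , v

  avoids-⊆ : ∀ {π π′} σ → π ⊆ π′ → contains π′ σ ≡ false → contains π σ ≡ false
  avoids-⊆ {π} σ π⊆π′ avoids = ¬-not (λ c → not-¬ (contains-⊆ σ π⊆π′ c) avoids)

  contains-skew-132 : ∀ P Q → Separated below P Q → contains (P ++ Q) p132 ≡ true →
    contains P p132 ≡ true ⊎ contains Q p132 ≡ true
  contains-skew-132 P Q sep e with contains-++⁻ below P Q p132 sep e
  ... | [] , _ , refl , _ , _ , Q⊇ = inj₂ Q⊇
  ... | _ ∷ [] , _ , refl , ((s≤s () ∷ _) ∷ _) , _ , _
  ... | _ ∷ _ ∷ [] , _ , refl , ((s≤s () ∷ _) ∷ _) , _ , _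
  ... | _ ∷ _ ∷ _ ∷ [] , [] , refl , _ , P⊇ , _ = inj₁ P⊇

  sameOrder-132 : ∀ {x M y} → x < y → y < M → sameOrder (x ∷ M ∷ y ∷ []) p132 ≡ true
  sameOrder-132 {x} {M} {y} x<y y<M
    rewrite <ᵇ-true (<-trans x<y y<M) | <ᵇ-false {M} {x} (<-trans x<y y<M) | <ᵇ-true x<y | <ᵇ-false {y} {x} x<y
          | <ᵇ-true y<M | <ᵇ-false {M} {y} y<M = refl

  opaque
    𝔐 : ℕ → List (List ℕ)
    𝔐 n = filterᵇ isMotzkin (perms n)

    ∈-𝔐⁺ : ∀ {n π} → π ∈ perms n → isMotzkin π ≡ true → π ∈ 𝔐 n
    ∈-𝔐⁺ π∈ m = ∈-filter⁺ (T? ∘ isMotzkin) π∈ (Equivalence.from T-≡ m)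

    ∈-𝔐⁻ : ∀ {n π} → π ∈ 𝔐 n → π ∈ perms n × isMotzkin π ≡ true
    ∈-𝔐⁻ π∈ with ∈-filter⁻ (T? ∘ isMotzkin) π∈
    ... | π∈perms , m = π∈perms , Equivalence.to T-≡ m

    unique-𝔐 : ∀ n → Unique (𝔐 n)
    unique-𝔐 n = Unique.filter⁺ (T? ∘ isMotzkin) (unique-perms n)

  length-𝔐 : ∀ {n π} → π ∈ 𝔐 n → length π ≡ n
  length-𝔐 {n} π∈ = length≡ (perms⇒IsPerm n (proj₁ (∈-𝔐⁻ π∈)))

  join : List ℕ → List ℕ → List ℕ
  join γ β = (map (_+ suc (length β)) γ ++ suc (length β) ∷ []) ++ suc (suc (length γ + length β)) ∷ β

  data MotzkinSplit (n : ℕ) : List ℕ → Set where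
    max-first : ∀ {β} → β ∈ 𝔐 n → MotzkinSplit n (suc n ∷ β)
    max-inside : ∀ {γ β} → suc (length γ + length β) ≡ n → γ ∈ 𝔐 (length γ) → β ∈ 𝔐 (length β) →
      MotzkinSplit n (join γ β)

  max-first∈𝔐 : ∀ {n β} → β ∈ 𝔐 n → suc n ∷ β ∈ 𝔐 (suc n)
  max-first∈𝔐 {n} {β} β∈ with ∈-𝔐⁻ β∈
  ... | β∈perms , motz with isMotzkin⁻ β motz
  ... | avoids , v = ∈-𝔐⁺ (insert-max n [] β β∈perms) (isMotzkin⁺ (suc n ∷ β)
    (trans (contains-cons-max (perm-below-max β∈perms) (here refl) (s≤s (s≤s z≤n))) avoids)
    (trans (noVinc-max-first [] (suc n) β (perm-below-max β∈perms) (All.tabulate (λ _ → refl))) v))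

  module JoinLayout (γ β : List ℕ) (γ∈ : γ ∈ perms (length γ)) (β∈ : β ∈ perms (length β)) where

    i = length γ
    j = length β
    top = suc (suc (i + j))
    γ↑ = map (_+ suc j) γ
    α = γ↑ ++ suc j ∷ []

    γ↑-bounds : All (Between (suc j) (suc (i + j))) γ↑
    γ↑-bounds = All.map⁺ (All.map shift (bounded (perms⇒IsPerm i γ∈)))
      where
      shift : ∀ {x} → Between 0 i x → Between (suc j) (suc (i + j)) (x + suc j)
      shift {x} (0<x , x≤i) = m<n+m (suc j) 0<x , subst (x + suc j ≤_) (+-suc i j) (+-monoˡ-≤ (suc j) x≤i)

    γ↑>j+1 : All (suc j <_) γ↑
    γ↑>j+1 = All.map proj₁ γ↑-bounds

    α<top : All (_< top) α
    α<top = All.++⁺ (All.map (λ (_ , x≤n) → s≤s x≤n) γ↑-bounds) (s≤s (s≤s (m≤n+m j i)) ∷ [])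

    β<j+1 : All (_< suc j) β
    β<j+1 = perm-below-max β∈

    β<top : All (_< top) β
    β<top = All.map (λ y<j+1 → <-trans y<j+1 (s≤s (s≤s (m≤n+m j i)))) β<j+1

    α-above-β : Separated below α β
    α-above-β = All.++⁺ (All.map (λ j+1<x → All.map (λ y<j+1 → <-trans y<j+1 j+1<x) β<j+1) γ↑>j+1) (β<j+1 ∷ [])

    α+top-above-β : Separated below (α ++ top ∷ []) β
    α+top-above-β = All.++⁺ α-above-β (β<top ∷ [])

  join∈𝔐 : ∀ {i j γ β} → γ ∈ 𝔐 i → β ∈ 𝔐 j → join γ β ∈ 𝔐 (suc (suc (i + j)))
  join∈𝔐 {γ = γ} {β} γ∈ β∈ with length-𝔐 γ∈ | length-𝔐 β∈ | ∈-𝔐⁻ γ∈ | ∈-𝔐⁻ β∈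
  ... | refl | refl | γ∈perms , γ-motz | β∈perms , β-motz = ∈-𝔐⁺ π∈perms (isMotzkin⁺ (join γ β) avoids v)
    where
    open JoinLayout γ β γ∈perms β∈perms
    γ-avoids = proj₁ (isMotzkin⁻ γ γ-motz)
    β-avoids = proj₁ (isMotzkin⁻ β β-motz)
    π∈perms : join γ β ∈ perms top
    π∈perms = insert-max (suc (i + j)) α β (IsPerm⇒perms (suc (i + j)) (subst₂ IsPerm (+-suc i j) (sym (++-assoc γ↑ (suc j ∷ []) β))
      (skew-perm (perms⇒IsPerm i γ∈perms) (perms⇒IsPerm (suc j) (insert-max j [] β β∈perms)))))
    avoids : contains (join γ β) p132 ≡ false
    avoids = ¬-not λ c → case (contains-skew-132 (α ++ top ∷ []) β α+top-above-β
      (subst (λ π → contains π p132 ≡ true) (sym (++-assoc α (top ∷ []) β)) c))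
      where
      case : contains (α ++ top ∷ []) p132 ≡ true ⊎ contains β p132 ≡ true → ⊥
      case (inj₂ c) = not-¬ c β-avoids
      case (inj₁ c) = not-¬ (trans (sym (contains-shift (suc j) γ p132))
        (contains-snoc-skip below {γ↑} {suc j} {1 ∷ 3 ∷ []} {2} γ↑>j+1 (here refl) (s≤s (s≤s z≤n))
          (contains-snoc-skip above {α} {top} {1 ∷ 3 ∷ []} {2} α<top (there (here refl)) (s≤s (s≤s (s≤s z≤n))) c))) γ-avoids
    v : noVinc [] (join γ β) ≡ true
    v = trans (noVinc-++ [] α top β) (∧-true⁺ v-α v-β)
      where
      v-β : noVinc (α ʳ++ []) (top ∷ β) ≡ true
      v-β = trans (noVinc-max-first (α ʳ++ []) top β β<top (noneBelow⁺ α β α-above-β)) (proj₂ (isMotzkin⁻ β β-motz))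
      v-α : noVinc [] (α ++ top ∷ []) ≡ true
      v-α rewrite ++-assoc γ↑ (suc j ∷ []) (top ∷ []) | noVinc-++ [] γ↑ (suc j) (top ∷ []) =
        ∧-true⁺
          (trans (noVinc-snoc-min [] γ↑ (suc j) γ↑>j+1) (trans (noVinc-map (_+ suc j) (+-<ᵇ (suc j)) [] γ) (proj₂ (isMotzkin⁻ γ γ-motz))))
          (noVinc-pair (γ↑ ʳ++ []) (suc j) top (All.head (noneBelow⁺ γ↑ (suc j ∷ []) (All.map (_∷ []) γ↑>j+1))))

  skew-around-max : ∀ α M β → contains (α ++ M ∷ β) p132 ≡ false → All (_< M) (α ++ β) → Unique (α ++ β) →
    Separated below α β
  skew-around-max α M β avoids below-M u = All.tabulate λ a∈α → All.tabulate λ b∈β → below-a a∈α b∈β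
    where
    below-a : ∀ {a b} → a ∈ α → b ∈ β → b < a
    below-a {a} {b} a∈α b∈β with <-cmp b a
    ... | tri< b<a _ _ = b<a
    ... | tri≈ _ b≡a _ = contradiction (sym b≡a) (Unique-++-disjoint α u a∈α b∈β)
    ... | tri> _ _ a<b = contradiction
      (contains⁺ (Sublist.++⁺ (from∈ a∈α) (refl ∷ from∈ b∈β)) (sameOrder-132 a<b (All.lookup below-M (∈-++⁺ʳ α b∈β))))
      (λ c → not-¬ c avoids)

  ascent-left-not-below : ∀ γ′ m M β → noVinc [] (γ′ ++ m ∷ M ∷ β) ≡ true → m < M → All (λ x → ¬ x < m) γ′
  ascent-left-not-below γ′ m M β v m<M =
    All.tabulate λ x∈γ′ x<m → not-¬ (anyB⁺ (λ a → a <ᵇ m) x∈γ′ (<ᵇ-true x<m)) none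
    where
    after-γ′ : noVinc (γ′ ʳ++ []) (m ∷ M ∷ β) ≡ true
    after-γ′ = proj₂ (∧-true⁻ {noVinc [] (γ′ ++ m ∷ [])} (trans (sym (noVinc-++ [] γ′ m (M ∷ β))) v))
    none : anyB (λ a → a <ᵇ m) γ′ ≡ false
    none = trans (sym (∨-identityʳ _)) (trans (sym (anyB-ʳ++ (λ a → a <ᵇ m) γ′ []))
      (subst (λ b → b ∧ anyB (λ a → a <ᵇ m) (γ′ ʳ++ []) ≡ false) (<ᵇ-true m<M)
        (not-true⁻ (proj₁ (∧-true⁻ {not ((m <ᵇ M) ∧ anyB (λ a → a <ᵇ m) (γ′ ʳ++ []))} after-γ′)))))

  motzkin-after-max : ∀ α M β → isMotzkin (α ++ M ∷ β) ≡ true → All (_< M) β → Separated below α β →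
    isMotzkin β ≡ true
  motzkin-after-max α M β motz β<M sep with isMotzkin⁻ (α ++ M ∷ β) motz
  ... | avoids , v = isMotzkin⁺ β
    (avoids-⊆ p132 (Sublist.++⁺ˡ α (M ∷ʳ ⊆-refl)) avoids)
    (trans (sym (noVinc-max-first (α ʳ++ []) M β β<M (noneBelow⁺ α β sep)))
      (proj₂ (∧-true⁻ {noVinc [] (α ++ M ∷ [])} (trans (sym (noVinc-++ [] α M β)) v))))

  motzkin-shifted-prefix : ∀ c γ rest → isMotzkin (map (_+ c) γ ++ rest) ≡ true → isMotzkin γ ≡ true
  motzkin-shifted-prefix c γ rest motz with isMotzkin⁻ (map (_+ c) γ ++ rest) motz
  ... | avoids , v = isMotzkin⁺ γ
    (trans (sym (contains-shift c γ p132)) (avoids-⊆ p132 (⊆-++ʳ (map (_+ c) γ) rest) avoids))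
    (trans (sym (noVinc-map (_+ c) (+-<ᵇ c) [] γ)) (noVinc-prefix [] (map (_+ c) γ) rest v))

  private
    split-inside : ∀ {n} γ′ m β → IsPerm n (γ′ ++ m ∷ β) → Separated below γ′ (m ∷ β) → All (_< m) β →
      isMotzkin ((γ′ ++ m ∷ []) ++ suc n ∷ β) ≡ true → isMotzkin β ≡ true → MotzkinSplit n ((γ′ ++ m ∷ []) ++ suc n ∷ β)
    split-inside {n} γ′ m β p sep β<m motz β-motz with skew-split γ′ (m ∷ β) p sep
    ... | pmβ , γ , refl , pγ with max-first-perm pmβ β<m
    ... | refl , pβ with trans (sym (length≡ p)) (length-skewed γ β)
      where
      length-skewed : ∀ γ β → length (map (_+ suc (length β)) γ ++ suc (length β) ∷ β) ≡ suc (length γ + length β)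
      length-skewed γ β = trans (length-++ (map _ γ)) (trans (cong (_+ suc (length β)) (length-map _ γ)) (+-suc (length γ) (length β)))
    ... | refl = max-inside refl
      (∈-𝔐⁺ {length γ} (IsPerm⇒perms _ (subst (λ k → IsPerm k γ) (length-map _ γ) pγ))
        (motzkin-shifted-prefix (suc (length β)) γ (suc (length β) ∷ suc n ∷ β)
          (subst (λ π → isMotzkin π ≡ true) (++-assoc (map (_+ suc (length β)) γ) (suc (length β) ∷ []) (suc n ∷ β)) motz)))
      (∈-𝔐⁺ {length β} (IsPerm⇒perms _ pβ) β-motz)

    split-at-max : ∀ {n} α β → InitLast α → IsPerm n (α ++ β) → isMotzkin (α ++ suc n ∷ β) ≡ true →
      MotzkinSplit n (α ++ suc n ∷ β)
    split-at-max {n} .[] β [] p motz =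
      max-first (∈-𝔐⁺ {n} (IsPerm⇒perms n p) (motzkin-after-max [] (suc n) β motz (All.map (λ (_ , x≤n) → s≤s x≤n) (bounded p)) []))
    split-at-max {n} .(γ′ ++ m ∷ []) β (γ′ ∷ʳ′ m) p motz =
      split-inside γ′ m β (subst (IsPerm n) (++-assoc γ′ (m ∷ []) β) p) sep′ (All.lookup sep m∈α) motz β-motz
      where
      α = γ′ ++ m ∷ []
      m∈α = ∈-++⁺ʳ γ′ (here refl)
      below-max : All (_< suc n) (α ++ β)
      below-max = All.map (λ (_ , x≤n) → s≤s x≤n) (bounded p)
      sep : Separated below α β
      sep = skew-around-max α (suc n) β (proj₁ (isMotzkin⁻ (α ++ suc n ∷ β) motz)) below-max (unique p)
      β-motz : isMotzkin β ≡ true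
      β-motz = motzkin-after-max α (suc n) β motz (All.++⁻ʳ α below-max) sep
      not-below : All (λ x → ¬ x < m) γ′
      not-below = ascent-left-not-below γ′ m (suc n) β
        (subst (λ π → noVinc [] π ≡ true) (++-assoc γ′ (m ∷ []) (suc n ∷ β)) (proj₂ (isMotzkin⁻ (α ++ suc n ∷ β) motz)))
        (All.lookup below-max (∈-++⁺ˡ m∈α))
      γ′-above-m : All (m <_) γ′
      γ′-above-m = All.tabulate λ {x} x∈γ′ →
        ≤∧≢⇒< (≮⇒≥ (All.lookup not-below x∈γ′))
          (λ m≡x → Unique-++-disjoint γ′ (subst Unique (++-assoc γ′ (m ∷ []) β) (unique p)) x∈γ′ (here refl) (sym m≡x))
      sep′ : Separated below γ′ (m ∷ β)
      sep′ = All.tabulate λ x∈γ′ → All.lookup γ′-above-m x∈γ′ ∷ All.lookup sep (∈-++⁺ˡ x∈γ′)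

  decompose : ∀ n {π} → π ∈ 𝔐 (suc n) → MotzkinSplit n π
  decompose n π∈ with ∈-𝔐⁻ {suc n} π∈
  ... | π∈perms , motz with perms⇒IsPerm (suc n) π∈perms
  ... | p with ∈-∃++ (max∈perm p)
  ... | α , β , refl = split-at-max α β (initLast α) (remove-max α β p) motz

  -- Counting Motzkin permutations

  length-join : ∀ γ β → length (join γ β) ≡ suc (suc (length γ + length β))
  length-join γ β = begin
    length (α ++ top ∷ β)                     ≡⟨ length-++ α ⟩
    length α + suc (length β)                 ≡⟨ cong (_+ suc (length β)) (trans (length-++ (map _ γ)) (cong (_+ 1) (length-map _ γ))) ⟩
    (length γ + 1) + suc (length β)           ≡⟨ arith (length γ) (length β) ⟩
    suc (suc (length γ + length β))           ∎
    where
    open ≡-Reasoning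
    α = map (_+ suc (length β)) γ ++ suc (length β) ∷ []
    top = suc (suc (length γ + length β))
    arith : ∀ a b → (a + 1) + suc b ≡ suc (suc (a + b))
    arith = solve-∀

  join-injective : ∀ {γ β γ′ β′} → Unique (join γ β) → join γ β ≡ join γ′ β′ → γ ≡ γ′ × β ≡ β′
  join-injective {γ} {β} {γ′} {β′} u e
    with ∷-middle-injective (∉-before α u) (∉-before α′ (subst Unique e′ u)) e′
    where
    α = map (_+ suc (length β)) γ ++ suc (length β) ∷ []
    α′ = map (_+ suc (length β′)) γ′ ++ suc (length β′) ∷ []
    e′ : α ++ suc (suc (length γ + length β)) ∷ β ≡ α′ ++ suc (suc (length γ + length β)) ∷ β′
    e′ = trans e (cong (λ N → α′ ++ N ∷ β′) (trans (sym (length-join γ′ β′)) (trans (sym (cong length e)) (length-join γ β))))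
  ... | α≡α′ , refl = map-injective (λ {x} {y} → +-cancelʳ-≡ (suc (length β)) x y) (∷ʳ-injectiveˡ _ _ α≡α′) , refl

  join-max-not-first : ∀ {n γ β β₀} → Unique (join γ β) → join γ β ≡ suc n ∷ β₀ → length β₀ ≡ n → ⊥
  join-max-not-first {n} {γ} {β} {β₀} u e refl = snoc≢[] (map _ γ) _ (proj₁ (∷-middle-injective (∉-before α u) (λ ()) e′))
    where
    α = map (_+ suc (length β)) γ ++ suc (length β) ∷ []
    e′ : α ++ suc (suc (length γ + length β)) ∷ β ≡ [] ++ suc (suc (length γ + length β)) ∷ β₀
    e′ = trans e (cong (_∷ β₀) (trans (sym (cong length e)) (length-join γ β)))
    snoc≢[] : ∀ (xs : List ℕ) y → xs ++ y ∷ [] ≢ []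
    snoc≢[] [] y ()
    snoc≢[] (_ ∷ _) y ()

  joins : ℕ → ℕ → List (List ℕ)
  joins i j = map (uncurry join) (cartesianProduct (𝔐 i) (𝔐 j))

  -- the Motzkin permutations of length n + 1 whose maximum is not in first position
  inside : ℕ → List (List ℕ)
  inside zero = []
  inside (suc m) = concatMap (λ i → joins i (m ∸ i)) (upTo' m)

  ∈-inside⁻ : ∀ m {π} → π ∈ inside (suc m) → ∃[ i ] ∃₂ λ γ β → i ≤ m × γ ∈ 𝔐 i × β ∈ 𝔐 (m ∸ i) × π ≡ join γ β
  ∈-inside⁻ m π∈ with find (∈-concatMap⁻ (λ i → joins i (m ∸ i)) {xs = upTo' m} π∈)
  ... | i , i∈ , π∈joins with ∈-map⁻ (uncurry join) π∈joins
  ... | (γ , β) , γβ∈ , refl with ∈-cartesianProduct⁻ (𝔐 i) (𝔐 (m ∸ i)) γβ∈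
  ... | γ∈ , β∈ = i , γ , β , ∈-upTo′⁻ m i∈ , γ∈ , β∈ , refl

  ∈-inside⁺ : ∀ {m i γ β} → i ≤ m → γ ∈ 𝔐 i → β ∈ 𝔐 (m ∸ i) → join γ β ∈ inside (suc m)
  ∈-inside⁺ {m} i≤m γ∈ β∈ =
    ∈-concatMap⁺ (λ i → joins i (m ∸ i)) (lose (∈-upTo′⁺ i≤m) (∈-map⁺ (uncurry join) (∈-cartesianProduct⁺ γ∈ β∈)))

  unique-join∈𝔐 : ∀ {i j γ β} → γ ∈ 𝔐 i → β ∈ 𝔐 j → Unique (join γ β)
  unique-join∈𝔐 {i} {j} γ∈ β∈ = unique (perms⇒IsPerm (suc (suc (i + j))) (proj₁ (∈-𝔐⁻ (join∈𝔐 γ∈ β∈))))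

  join-injective-on-𝔐 : ∀ {i j γ β γ′ β′} → γ ∈ 𝔐 i → β ∈ 𝔐 j → join γ β ≡ join γ′ β′ → (γ , β) ≡ (γ′ , β′)
  join-injective-on-𝔐 {i} {j} {γ} {β} {γ′} {β′} γ∈ β∈ e =
    let (γ≡γ′ , β≡β′) = join-injective {γ} {β} {γ′} {β′} (unique-join∈𝔐 {i} {j} γ∈ β∈) e in cong₂ _,_ γ≡γ′ β≡β′

  unique-joins : ∀ i j → Unique (joins i j)
  unique-joins i j = Unique-map-local (uncurry join) injective (Unique.cartesianProduct⁺ (unique-𝔐 i) (unique-𝔐 j))
    where
    injective : ∀ {x y} → x ∈ cartesianProduct (𝔐 i) (𝔐 j) → y ∈ cartesianProduct (𝔐 i) (𝔐 j) →
      uncurry join x ≡ uncurry join y → x ≡ y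
    injective {x} x∈ _ = let (γ∈ , β∈) = ∈-cartesianProduct⁻ (𝔐 i) (𝔐 j) {x} x∈ in join-injective-on-𝔐 γ∈ β∈

  joins-disjoint : ∀ {i j i′ j′ π} → π ∈ joins i j → π ∈ joins i′ j′ → i ≡ i′
  joins-disjoint {i} {j} {i′} {j′} π∈ π∈′ with ∈-map⁻ (uncurry join) π∈ | ∈-map⁻ (uncurry join) π∈′
  ... | (γ , β) , γβ∈ , refl | (γ′ , β′) , γβ∈′ , e =
    let (γ∈ , β∈) = ∈-cartesianProduct⁻ (𝔐 i) (𝔐 j) γβ∈
        (γ′∈ , _) = ∈-cartesianProduct⁻ (𝔐 i′) (𝔐 j′) γβ∈′
    in trans (sym (length-𝔐 γ∈)) (trans (cong (length ∘ proj₁) (join-injective-on-𝔐 γ∈ β∈ e)) (length-𝔐 γ′∈))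

  unique-inside : ∀ n → Unique (inside n)
  unique-inside zero = []
  unique-inside (suc m) = Unique-concatMap (λ i → joins i (m ∸ i)) (Unique-upTo′ m)
    (λ {i} _ → unique-joins i (m ∸ i)) (λ _ _ → joins-disjoint)

  inside⊆𝔐 : ∀ n {π} → π ∈ inside n → π ∈ 𝔐 (suc n)
  inside⊆𝔐 (suc m) π∈ with ∈-inside⁻ m π∈
  ... | i , γ , β , i≤m , γ∈ , β∈ , refl = subst (λ k → join γ β ∈ 𝔐 (suc (suc k))) (m+[n∸m]≡n i≤m) (join∈𝔐 {i} {m ∸ i} γ∈ β∈)

  max-first∉inside : ∀ n {β₀} → β₀ ∈ 𝔐 n → suc n ∷ β₀ ∈ inside n → ⊥
  max-first∉inside (suc m) β₀∈ π∈ with ∈-inside⁻ m π∈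
  ... | i , γ , β , _ , γ∈ , β∈ , e = join-max-not-first (unique-join∈𝔐 {i} {m ∸ i} γ∈ β∈) (sym e) (length-𝔐 {suc m} β₀∈)

  𝔐-split : ℕ → List (List ℕ)
  𝔐-split n = map (suc n ∷_) (𝔐 n) ++ inside n

  𝔐⊆𝔐-split : ∀ n {π} → π ∈ 𝔐 (suc n) → π ∈ 𝔐-split n
  𝔐⊆𝔐-split n π∈ with decompose n π∈
  ... | max-first β∈ = ∈-++⁺ˡ (∈-map⁺ (suc n ∷_) β∈)
  ... | max-inside {γ} {β} refl γ∈ β∈ =
    ∈-++⁺ʳ (map (suc n ∷_) (𝔐 n)) (∈-inside⁺ {length γ + length β} {length γ} (m≤m+n (length γ) (length β)) γ∈
      (subst (λ k → β ∈ 𝔐 k) (sym (m+n∸m≡n (length γ) (length β))) β∈))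

  𝔐-split⊆𝔐 : ∀ n {π} → π ∈ 𝔐-split n → π ∈ 𝔐 (suc n)
  𝔐-split⊆𝔐 n π∈ with ∈-++⁻ (map (suc n ∷_) (𝔐 n)) π∈
  ... | inj₂ π∈inside = inside⊆𝔐 n π∈inside
  ... | inj₁ π∈max-first with ∈-map⁻ (suc n ∷_) π∈max-first
  ...   | β , β∈ , refl = max-first∈𝔐 {n} β∈

  unique-𝔐-split : ∀ n → Unique (𝔐-split n)
  unique-𝔐-split n = Unique.++⁺ (Unique.map⁺ ∷-injectiveʳ (unique-𝔐 n)) (unique-inside n) disjoint
    where
    disjoint : ∀ {π} → π ∈ map (suc n ∷_) (𝔐 n) × π ∈ inside n → ⊥
    disjoint (π∈max-first , π∈inside) with ∈-map⁻ (suc n ∷_) π∈max-first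
    ... | β₀ , β₀∈ , refl = max-first∉inside n β₀∈ π∈inside

  #𝔐 : (List ℕ → Bool) → ℕ → ℕ
  #𝔐 Q n = length (filterᵇ Q (𝔐 n))

  #joins : (List ℕ → Bool) → ℕ → ℕ → ℕ
  #joins Q i j = length (filterᵇ (Q ∘ uncurry join) (cartesianProduct (𝔐 i) (𝔐 j)))

  #𝔐-suc : ∀ Q n → #𝔐 Q (suc n) ≡ #𝔐 (Q ∘ (suc n ∷_)) n + length (filterᵇ Q (inside n))
  #𝔐-suc Q n = begin
    #𝔐 Q (suc n)
      ≡⟨ length-filterᵇ-same-elements Q (unique-𝔐 (suc n)) (unique-𝔐-split n) (𝔐⊆𝔐-split n) (𝔐-split⊆𝔐 n) ⟩
    length (filterᵇ Q (𝔐-split n))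
      ≡⟨ length-filterᵇ-++ Q (map (suc n ∷_) (𝔐 n)) (inside n) ⟩
    length (filterᵇ Q (map (suc n ∷_) (𝔐 n))) + length (filterᵇ Q (inside n))
      ≡⟨ cong (_+ length (filterᵇ Q (inside n))) (length-filterᵇ-map Q (suc n ∷_) (𝔐 n)) ⟩
    #𝔐 (Q ∘ (suc n ∷_)) n + length (filterᵇ Q (inside n)) ∎
    where open ≡-Reasoning

  #inside : ∀ Q m → length (filterᵇ Q (inside (suc m))) ≡ sum (map (λ i → #joins Q i (m ∸ i)) (upTo' m))
  #inside Q m = trans (length-filterᵇ-concatMap Q (λ i → joins i (m ∸ i)) (upTo' m))
    (cong sum (map-cong (λ i → length-filterᵇ-map Q (uncurry join) (cartesianProduct (𝔐 i) (𝔐 (m ∸ i)))) (upTo' m)))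

  avoids : List ℕ → List ℕ → Bool
  avoids σ π = not (contains π σ)

  opaque
    unfolding 𝔐

    countM≡#𝔐 : ∀ σ n → countM σ n ≡ #𝔐 (avoids σ) n
    countM≡#𝔐 σ n = cong length (sym (filterᵇ-filterᵇ isMotzkin (avoids σ) (perms n)))

  countM-zero : ∀ σ → contains [] σ ≡ false → countM σ 0 ≡ 1
  countM-zero σ e = cong length (filterᵇ-cong {p = λ π → isMotzkin π ∧ not (contains π σ)} {q = λ _ → true} (perms 0)
    λ { (here refl) → cong not e })

  #max-first : ∀ σ → FrontMaxIrrelevant σ → ∀ n → #𝔐 (avoids σ ∘ (suc n ∷_)) n ≡ countM σ n
  #max-first σ irrelevant n = trans
    (cong length (filterᵇ-cong (𝔐 n) (λ {β} β∈ → cong not (irrelevant (suc n) β (perm-below-max (proj₁ (∈-𝔐⁻ β∈)))))))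
    (sym (countM≡#𝔐 σ n))

  countM-one : ∀ σ → FrontMaxIrrelevant σ → countM σ 1 ≡ countM σ 0
  countM-one σ irrelevant = trans (countM≡#𝔐 σ 1) (trans (#𝔐-suc (avoids σ) 0) (trans (+-identityʳ _) (#max-first σ irrelevant 0)))

  countM-recurrence : ∀ σ → FrontMaxIrrelevant σ → ∀ m →
    countM σ (suc (suc m)) ≡ countM σ (suc m) + sum (map (λ i → #joins (avoids σ) i (m ∸ i)) (upTo' m))
  countM-recurrence σ irrelevant m =
    trans (countM≡#𝔐 σ (suc (suc m))) (trans (#𝔐-suc (avoids σ) (suc m))
      (cong₂ _+_ (#max-first σ irrelevant (suc m)) (#inside (avoids σ) m)))

  on-𝔐-pairs : ∀ {i j} {P : List ℕ × List ℕ → Set} → (∀ {γ β} → γ ∈ 𝔐 i → β ∈ 𝔐 j → P (γ , β)) →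
    ∀ {z} → z ∈ cartesianProduct (𝔐 i) (𝔐 j) → P z
  on-𝔐-pairs {i} {j} f {γ , β} z∈ = let (γ∈ , β∈) = ∈-cartesianProduct⁻ (𝔐 i) (𝔐 j) z∈ in f γ∈ β∈

  ∈𝔐⇒∈perms-length : ∀ {n π} → π ∈ 𝔐 n → π ∈ perms (length π)
  ∈𝔐⇒∈perms-length {n} π∈ = subst (λ k → _ ∈ perms k) (sym (length-𝔐 π∈)) (proj₁ (∈-𝔐⁻ π∈))

  -- The pattern τ

  module Pattern (k t : ℕ) (ρ′ θ′ : List ℕ)
    (τ∈ : (ρ′ ++ t ∷ k ∷ []) ++ (θ′ ++ 1 ∷ (t ∸ 1) ∷ []) ∈ perms k)
    (ρ′>t : All (t <_) ρ′) (θ′<t : All (_< t) θ′) where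

    τ₁ τ₂ τ ρ θ : List ℕ
    τ₁ = ρ′ ++ t ∷ k ∷ []
    τ₂ = θ′ ++ 1 ∷ (t ∸ 1) ∷ []
    τ = τ₁ ++ τ₂
    ρ = map (_∸ t) ρ′
    θ = map (_∸ 1) θ′

    private
      τ-perm = perms⇒IsPerm k τ∈
      τ₁-unique = Unique-⊆ (⊆-++ʳ τ₁ τ₂) (unique τ-perm)
      τ₂-unique = Unique-⊆ (⊆-++ˡ τ₁ τ₂) (unique τ-perm)
      τ₁-bounds = All.++⁻ˡ τ₁ (bounded τ-perm)
      τ₂-bounds = All.++⁻ʳ τ₁ (bounded τ-perm)

    t<k : t < k
    t<k with Unique-⊆ (⊆-++ˡ ρ′ (t ∷ k ∷ [])) τ₁-unique | All.++⁻ʳ ρ′ τ₁-bounds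
    ... | (t≢k ∷ []) ∷ _ | (_ , t≤k) ∷ _ = ≤∧≢⇒< t≤k t≢k

    ρ′<k : All (_< k) ρ′
    ρ′<k = All.tabulate λ x∈ρ′ →
      ≤∧≢⇒< (proj₂ (All.lookup (All.++⁻ˡ ρ′ τ₁-bounds) x∈ρ′)) (Unique-++-disjoint ρ′ τ₁-unique x∈ρ′ (there (here refl)))

    1<t-1 : 1 < t ∸ 1
    1<t-1 with Unique-⊆ (⊆-++ˡ θ′ (1 ∷ (t ∸ 1) ∷ [])) τ₂-unique | All.++⁻ʳ θ′ τ₂-bounds
    ... | (1≢t-1 ∷ []) ∷ _ | _ ∷ (0<t-1 , _) ∷ [] = ≤∧≢⇒< 0<t-1 1≢t-1

    t-1<t : t ∸ 1 < t
    t-1<t = ∸-monoʳ-< {t} {1} {0} z<s (<⇒≤ (<-≤-trans 1<t-1 (m∸n≤m t 1)))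

    θ′>1 : All (1 <_) θ′
    θ′>1 = All.tabulate λ x∈θ′ →
      ≤∧≢⇒< (proj₁ (All.lookup (All.++⁻ˡ θ′ τ₂-bounds) x∈θ′)) (λ 1≡x → Unique-++-disjoint θ′ τ₂-unique x∈θ′ (here refl) (sym 1≡x))

    θ′<t-1 : All (_< t ∸ 1) θ′
    θ′<t-1 = All.tabulate λ {x} x∈θ′ →
      ≤∧≢⇒< (subst (x ≤_) (pred[m∸n]≡m∸[1+n] t 0) (<⇒≤pred (All.lookup θ′<t x∈θ′)))
             (Unique-++-disjoint θ′ τ₂-unique x∈θ′ (there (here refl)))

    τ₁-above-τ₂ : Separated below τ₁ τ₂
    τ₁-above-τ₂ = All.map (λ t≤a → All.map (λ b<t → <-≤-trans b<t t≤a) τ₂<t) τ₁≥t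
      where
      τ₂<t = All.++⁺ θ′<t (<-trans 1<t-1 t-1<t ∷ t-1<t ∷ [])
      τ₁≥t = All.++⁺ (All.map <⇒≤ ρ′>t) (≤-refl ∷ <⇒≤ t<k ∷ [])

    τ₁-indecomposable : SkewIndecomposable τ₁
    τ₁-indecomposable = subst SkewIndecomposable (++-assoc ρ′ (t ∷ []) (k ∷ []))
      (ends-with-max⇒indecomposable (ρ′ ++ t ∷ []) k (All.++⁺ ρ′<k (t<k ∷ [])))

    τ₂-indecomposable : SkewIndecomposable τ₂
    τ₂-indecomposable = subst SkewIndecomposable (++-assoc θ′ (1 ∷ []) (t ∸ 1 ∷ []))
      (ends-with-max⇒indecomposable (θ′ ++ 1 ∷ []) (t ∸ 1) (All.++⁺ θ′<t-1 (1<t-1 ∷ [])))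

    τ-as-ρ′-prefix : τ ≡ ρ′ ++ t ∷ k ∷ τ₂
    τ-as-ρ′-prefix = ++-assoc ρ′ (t ∷ k ∷ []) τ₂

    contains-τ⇒ρ : ∀ π → contains π τ ≡ true → contains π ρ ≡ true
    contains-τ⇒ρ π e = trans (contains-lower t π ρ′ (All.map <⇒≤ ρ′>t))
      (contains-prefix π ρ′ (t ∷ k ∷ τ₂) (subst (λ σ → contains π σ ≡ true) τ-as-ρ′-prefix e))

    contains-τ⇒τ₂ : ∀ π → contains π τ ≡ true → contains π τ₂ ≡ true
    contains-τ⇒τ₂ π = contains-suffix π τ₁ τ₂

    τ-front-max-irrelevant : FrontMaxIrrelevant τ
    τ-front-max-irrelevant = subst FrontMaxIrrelevant (sym τ-as-ρ′-prefix) (front-max-irrelevant ρ′ t k τ₂ ρ′<k t<k)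

    τ₂-front-max-irrelevant : FrontMaxIrrelevant τ₂
    τ₂-front-max-irrelevant = front-max-irrelevant θ′ 1 (t ∸ 1) [] θ′<t-1 1<t-1

    []-avoids-τ : contains [] τ ≡ false
    []-avoids-τ = subst (λ σ → contains [] σ ≡ false) (sym τ-as-ρ′-prefix) (contains-[]-nonempty ρ′ t (k ∷ τ₂))

    []-avoids-τ₂ : contains [] τ₂ ≡ false
    []-avoids-τ₂ = contains-[]-nonempty θ′ 1 (t ∸ 1 ∷ [])

    module _ {γ β : List ℕ} (γ∈ : γ ∈ perms (length γ)) (β∈ : β ∈ perms (length β)) where

      open JoinLayout γ β γ∈ β∈

      private
        P = α ++ top ∷ []

        join≡P++β : join γ β ≡ P ++ β
        join≡P++β = sym (++-assoc α (top ∷ []) β)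

        P-τ₁ : contains P τ₁ ≡ contains γ ρ
        P-τ₁ = begin
          contains P τ₁
            ≡⟨ cong (contains P) (sym (++-assoc ρ′ (t ∷ []) (k ∷ []))) ⟩
          contains (α ++ top ∷ []) ((ρ′ ++ t ∷ []) ++ k ∷ [])
            ≡⟨ contains-snoc-extremes above α top (ρ′ ++ t ∷ []) k α<top (All.++⁺ ρ′<k (t<k ∷ [])) ⟩
          contains (γ↑ ++ suc j ∷ []) (ρ′ ++ t ∷ [])
            ≡⟨ contains-snoc-extremes below γ↑ (suc j) ρ′ t γ↑>j+1 ρ′>t ⟩
          contains γ↑ ρ′
            ≡⟨ contains-shift (suc j) γ ρ′ ⟩
          contains γ ρ′
            ≡⟨ contains-lower t γ ρ′ (All.map <⇒≤ ρ′>t) ⟨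
          contains γ ρ ∎
          where open ≡-Reasoning

        P-τ₂ : contains P τ₂ ≡ contains γ θ
        P-τ₂ = begin
          contains P τ₂
            ≡⟨ cong (contains P) (sym (++-assoc θ′ (1 ∷ []) (t ∸ 1 ∷ []))) ⟩
          contains (α ++ top ∷ []) ((θ′ ++ 1 ∷ []) ++ t ∸ 1 ∷ [])
            ≡⟨ contains-snoc-extremes above α top (θ′ ++ 1 ∷ []) (t ∸ 1) α<top (All.++⁺ θ′<t-1 (1<t-1 ∷ [])) ⟩
          contains (γ↑ ++ suc j ∷ []) (θ′ ++ 1 ∷ [])
            ≡⟨ contains-snoc-extremes below γ↑ (suc j) θ′ 1 γ↑>j+1 θ′>1 ⟩
          contains γ↑ θ′
            ≡⟨ contains-shift (suc j) γ θ′ ⟩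
          contains γ θ′
            ≡⟨ contains-lower 1 γ θ′ (All.map <⇒≤ θ′>1) ⟨
          contains γ θ ∎
          where open ≡-Reasoning

        P-τ : contains P τ ≡ true → contains γ τ ≡ true
        P-τ e = subst (λ σ → contains γ σ ≡ true) (sym τ≡σ++[t-1])
          (trans (sym (contains-shift (suc j) γ (σ ++ t ∸ 1 ∷ [])))
            (contains-snoc-skip below {γ↑} {suc j} {σ} {t ∸ 1} γ↑>j+1 (∈-++⁺ʳ τ₁ (∈-++⁺ʳ θ′ (here refl))) 1<t-1
              (contains-snoc-skip above {α} {top} {σ} {t ∸ 1} α<top (∈-++⁺ˡ (∈-++⁺ʳ ρ′ (there (here refl)))) (<-trans t-1<t t<k)
                (subst (λ σ → contains P σ ≡ true) τ≡σ++[t-1] e))))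
          where
          σ = τ₁ ++ θ′ ++ 1 ∷ []
          τ≡σ++[t-1] : τ ≡ σ ++ t ∸ 1 ∷ []
          τ≡σ++[t-1] = trans (cong (τ₁ ++_) (sym (++-assoc θ′ (1 ∷ []) (t ∸ 1 ∷ [])))) (sym (++-assoc τ₁ (θ′ ++ 1 ∷ []) (t ∸ 1 ∷ [])))

        γ↑⊆join : γ↑ ⊆ P ++ β
        γ↑⊆join = ⊆-trans (⊆-++ʳ γ↑ (suc j ∷ [])) (⊆-trans (⊆-++ʳ α (top ∷ [])) (⊆-++ʳ P β))

      contains-join-τ : contains (join γ β) τ ≡ (contains γ τ ∨ contains β τ) ∨ (contains γ ρ ∧ contains β τ₂)
      contains-join-τ = trans (cong (λ π → contains π τ) join≡P++β) (true⇔true⇒≡ to from)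
        where
        to : contains (P ++ β) τ ≡ true → (contains γ τ ∨ contains β τ) ∨ (contains γ ρ ∧ contains β τ₂) ≡ true
        to e with contains-++⁻ below P β τ α+top-above-β e
        ... | u , v , τ≡u++v , sep , P⊇u , β⊇v with skew-splittings τ₁ τ₂ τ₁-indecomposable τ₂-indecomposable u v (sym τ≡u++v) sep
        ...   | inj₁ (refl , refl) = ∨-true⁺ˡ (∨-true⁺ʳ {contains γ τ} β⊇v)
        ...   | inj₂ (inj₁ (refl , refl)) = ∨-true⁺ʳ {contains γ τ ∨ contains β τ} (∧-true⁺ (trans (sym P-τ₁) P⊇u) β⊇v)
        ...   | inj₂ (inj₂ (refl , refl)) = ∨-true⁺ˡ (∨-true⁺ˡ (P-τ P⊇u))
        from : (contains γ τ ∨ contains β τ) ∨ (contains γ ρ ∧ contains β τ₂) ≡ true → contains (P ++ β) τ ≡ true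
        from e with ∨-true⁻ {contains γ τ ∨ contains β τ} e
        ... | inj₂ both with ∧-true⁻ both
        ...   | γ⊇ρ , β⊇τ₂ = contains-++⁺ below α+top-above-β τ₁-above-τ₂ (trans P-τ₁ γ⊇ρ) β⊇τ₂
        from e | inj₁ one with ∨-true⁻ {contains γ τ} one
        ... | inj₁ γ⊇τ = contains-⊆ τ γ↑⊆join (trans (contains-shift (suc j) γ τ) γ⊇τ)
        ... | inj₂ β⊇τ = contains-⊆ τ (⊆-++ˡ P β) β⊇τ

      contains-join-τ₂ : contains (join γ β) τ₂ ≡ contains γ θ ∨ contains β τ₂
      contains-join-τ₂ = trans (cong (λ π → contains π τ₂) join≡P++β) (true⇔true⇒≡ to from)
        where
        to : contains (P ++ β) τ₂ ≡ true → contains γ θ ∨ contains β τ₂ ≡ true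
        to e with contains-++⁻ below P β τ₂ α+top-above-β e
        ... | u , v , τ₂≡u++v , sep , P⊇u , β⊇v with τ₂-indecomposable u v (sym τ₂≡u++v) sep
        ...   | inj₁ refl = ∨-true⁺ʳ {contains γ θ} (subst (λ σ → contains β σ ≡ true) (sym τ₂≡u++v) β⊇v)
        ...   | inj₂ refl = ∨-true⁺ˡ (trans (sym P-τ₂) (subst (λ σ → contains P σ ≡ true) (trans (sym (++-identityʳ u)) (sym τ₂≡u++v)) P⊇u))
        from : contains γ θ ∨ contains β τ₂ ≡ true → contains (P ++ β) τ₂ ≡ true
        from e with ∨-true⁻ {contains γ θ} e
        ... | inj₁ γ⊇θ = contains-⊆ τ₂ (⊆-++ʳ P β) (trans P-τ₂ γ⊇θ)
        ... | inj₂ β⊇τ₂ = contains-⊆ τ₂ (⊆-++ˡ P β) β⊇τ₂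

  module Recurrences (k t : ℕ) (ρ′ θ′ : List ℕ)
    (τ∈ : (ρ′ ++ t ∷ k ∷ []) ++ (θ′ ++ 1 ∷ (t ∸ 1) ∷ []) ∈ perms k)
    (ρ′>t : All (t <_) ρ′) (θ′<t : All (_< t) θ′) where

    open Pattern k t ρ′ θ′ τ∈ ρ′>t θ′<t

    d : ℕ → ℕ
    d = #𝔐 (λ π → contains π ρ ∧ avoids τ π)

    τ-count-split : ∀ n → countM τ n ≡ countM ρ n + d n
    τ-count-split n = begin
      countM τ n
        ≡⟨ countM≡#𝔐 τ n ⟩
      #𝔐 (avoids τ) n
        ≡⟨ length-filterᵇ-split (λ π → contains π ρ) (avoids τ) (𝔐 n) ⟩
      d n + #𝔐 (λ π → not (contains π ρ) ∧ avoids τ π) n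
        ≡⟨ cong (d n +_) (cong length (filterᵇ-cong (𝔐 n) (λ {π} _ → not-∧-not (contains-τ⇒ρ π)))) ⟩
      d n + #𝔐 (avoids ρ) n
        ≡⟨ cong (d n +_) (countM≡#𝔐 ρ n) ⟨
      d n + countM ρ n
        ≡⟨ +-comm (d n) (countM ρ n) ⟩
      countM ρ n + d n ∎
      where open ≡-Reasoning

    private
      split-on-ρ-yes : ∀ x g bτ bB → (bτ ≡ true → bB ≡ true) → x ∧ not ((g ∨ bτ) ∨ (x ∧ bB)) ≡ (x ∧ not g) ∧ not bB
      split-on-ρ-yes false g bτ bB _ = refl
      split-on-ρ-yes true true bτ bB _ = refl
      split-on-ρ-yes true false true true _ = refl
      split-on-ρ-yes true false false true _ = refl
      split-on-ρ-yes true false false false _ = refl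
      split-on-ρ-yes true false true false bτ⇒bB with bτ⇒bB refl
      ... | ()

      split-on-ρ-no : ∀ x g bτ bB → (g ≡ true → x ≡ true) → not x ∧ not ((g ∨ bτ) ∨ (x ∧ bB)) ≡ not x ∧ not bτ
      split-on-ρ-no true g bτ bB _ = refl
      split-on-ρ-no false false true bB _ = refl
      split-on-ρ-no false false false bB _ = refl
      split-on-ρ-no false true bτ bB g⇒x with g⇒x refl
      ... | ()

    #joins-τ : ∀ i j → #joins (avoids τ) i j ≡ countM ρ i * countM τ j + d i * countM τ₂ j
    #joins-τ i j = begin
      #joins (avoids τ) i j
        ≡⟨ length-filterᵇ-split (λ z → contains (proj₁ z) ρ) (avoids τ ∘ uncurry join) pairs ⟩
      length (filterᵇ (λ z → contains (proj₁ z) ρ ∧ avoids τ (uncurry join z)) pairs) +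
      length (filterᵇ (λ z → not (contains (proj₁ z) ρ) ∧ avoids τ (uncurry join z)) pairs)
        ≡⟨ cong₂ _+_ (cong length (filterᵇ-cong pairs (on-𝔐-pairs ρ-yes)))
                       (cong length (filterᵇ-cong pairs (on-𝔐-pairs ρ-no))) ⟩
      length (filterᵇ (λ z → (contains (proj₁ z) ρ ∧ avoids τ (proj₁ z)) ∧ avoids τ₂ (proj₂ z)) pairs) +
      length (filterᵇ (λ z → avoids ρ (proj₁ z) ∧ avoids τ (proj₂ z)) pairs)
        ≡⟨ cong₂ _+_ (length-filterᵇ-cartesianProduct _ (avoids τ₂) (𝔐 i) (𝔐 j))
                       (length-filterᵇ-cartesianProduct (avoids ρ) (avoids τ) (𝔐 i) (𝔐 j)) ⟩
      d i * #𝔐 (avoids τ₂) j + #𝔐 (avoids ρ) i * #𝔐 (avoids τ) j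
        ≡⟨ cong₂ _+_ (cong (d i *_) (countM≡#𝔐 τ₂ j)) (cong₂ _*_ (countM≡#𝔐 ρ i) (countM≡#𝔐 τ j)) ⟨
      d i * countM τ₂ j + countM ρ i * countM τ j
        ≡⟨ +-comm (d i * countM τ₂ j) _ ⟩
      countM ρ i * countM τ j + d i * countM τ₂ j ∎
      where
      open ≡-Reasoning
      pairs = cartesianProduct (𝔐 i) (𝔐 j)
      ρ-yes : ∀ {γ β} → γ ∈ 𝔐 i → β ∈ 𝔐 j →
        contains γ ρ ∧ avoids τ (join γ β) ≡ (contains γ ρ ∧ avoids τ γ) ∧ avoids τ₂ β
      ρ-yes {γ} {β} γ∈ β∈ = trans (cong (λ c → contains γ ρ ∧ not c) (contains-join-τ (∈𝔐⇒∈perms-length γ∈) (∈𝔐⇒∈perms-length β∈)))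
        (split-on-ρ-yes (contains γ ρ) (contains γ τ) (contains β τ) (contains β τ₂) (contains-τ⇒τ₂ β))
      ρ-no : ∀ {γ β} → γ ∈ 𝔐 i → β ∈ 𝔐 j →
        not (contains γ ρ) ∧ avoids τ (join γ β) ≡ avoids ρ γ ∧ avoids τ β
      ρ-no {γ} {β} γ∈ β∈ = trans (cong (λ c → not (contains γ ρ) ∧ not c) (contains-join-τ (∈𝔐⇒∈perms-length γ∈) (∈𝔐⇒∈perms-length β∈)))
        (split-on-ρ-no (contains γ ρ) (contains γ τ) (contains β τ) (contains β τ₂) (contains-τ⇒ρ γ))

    #joins-τ₂ : ∀ i j → #joins (avoids τ₂) i j ≡ countM θ i * countM τ₂ j
    #joins-τ₂ i j = begin
      #joins (avoids τ₂) i j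
          ≡⟨ cong length (filterᵇ-cong pairs (on-𝔐-pairs avoids-join)) ⟩
      length (filterᵇ (λ z → avoids θ (proj₁ z) ∧ avoids τ₂ (proj₂ z)) pairs)
        ≡⟨ length-filterᵇ-cartesianProduct (avoids θ) (avoids τ₂) (𝔐 i) (𝔐 j) ⟩
      #𝔐 (avoids θ) i * #𝔐 (avoids τ₂) j
        ≡⟨ cong₂ _*_ (countM≡#𝔐 θ i) (countM≡#𝔐 τ₂ j) ⟨
      countM θ i * countM τ₂ j ∎
      where
      open ≡-Reasoning
      pairs = cartesianProduct (𝔐 i) (𝔐 j)
      avoids-join : ∀ {γ β} → γ ∈ 𝔐 i → β ∈ 𝔐 j → avoids τ₂ (join γ β) ≡ avoids θ γ ∧ avoids τ₂ β
      avoids-join {γ} {β} γ∈ β∈ =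
        trans (cong not (contains-join-τ₂ (∈𝔐⇒∈perms-length γ∈) (∈𝔐⇒∈perms-length β∈))) (not-∨ (contains γ θ) (contains β τ₂))

    τ-count-zero : countM τ 0 ≡ 1
    τ-count-zero = countM-zero τ []-avoids-τ

    τ-count-one : countM τ 1 ≡ countM τ 0
    τ-count-one = countM-one τ τ-front-max-irrelevant

    τ-count-recurrence : ∀ m → countM τ (suc (suc m)) ≡
      countM τ (suc m) + sum (map (λ i → countM ρ i * countM τ (m ∸ i) + d i * countM τ₂ (m ∸ i)) (upTo' m))
    τ-count-recurrence m = trans (countM-recurrence τ τ-front-max-irrelevant m)
      (cong (countM τ (suc m) +_) (cong sum (map-cong (λ i → #joins-τ i (m ∸ i)) (upTo' m))))

    τ₂-count-zero : countM τ₂ 0 ≡ 1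
    τ₂-count-zero = countM-zero τ₂ []-avoids-τ₂

    τ₂-count-one : countM τ₂ 1 ≡ countM τ₂ 0
    τ₂-count-one = countM-one τ₂ τ₂-front-max-irrelevant

    τ₂-count-recurrence : ∀ m →
      countM τ₂ (suc (suc m)) ≡ countM τ₂ (suc m) + sum (map (λ i → countM θ i * countM τ₂ (m ∸ i)) (upTo' m))
    τ₂-count-recurrence m = trans (countM-recurrence τ₂ τ₂-front-max-irrelevant m)
      (cong (countM τ₂ (suc m) +_) (cong sum (map-cong (λ i → #joins-τ₂ i (m ∸ i)) (upTo' m))))

module PowerSeries where

  open import Data.Nat as ℕ using (ℕ; zero; suc; _∸_; _≤_; z≤n)
  import Data.Nat.Properties as ℕ
  open import Data.Nat.ListAction using (sum)
  open import Data.Integer using (ℤ; +_; _+_; _*_; _-_)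
  import Data.Integer.Properties as ℤ
  open import Data.Integer.Tactic.RingSolver using (solve-∀)
  open import Algebra.Bundles using (AbelianGroup)
  open import Algebra.Properties.Group (AbelianGroup.group ℤ.+-0-abelianGroup) using (∙-cancelˡ)
  open import Data.Sum using (inj₁; inj₂)
  open import Data.List using ([]; _∷_; _++_; map; foldr)
  open import Data.List.Properties using (map-++)
  open import Function using (_∘_)
  open import Relation.Binary.PropositionalEquality

  ∑ : ℕ → (ℕ → ℤ) → ℤ
  ∑ n F = foldr _+_ (+ 0) (map F (upTo' n))

  ∑-snoc : ∀ n F → ∑ (suc n) F ≡ ∑ n F + F (suc n)
  ∑-snoc n F = trans (cong (foldr _+_ (+ 0)) (map-++ F (upTo' n) (suc n ∷ []))) (foldr-snoc (map F (upTo' n)))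
    where
    foldr-snoc : ∀ xs → foldr _+_ (+ 0) (xs ++ F (suc n) ∷ []) ≡ foldr _+_ (+ 0) xs + F (suc n)
    foldr-snoc [] = trans (ℤ.+-identityʳ (F (suc n))) (sym (ℤ.+-identityˡ (F (suc n))))
    foldr-snoc (x ∷ xs) = trans (cong (_+_ x) (foldr-snoc xs)) (sym (ℤ.+-assoc x _ _))

  ∑-shift : ∀ n F → ∑ (suc n) F ≡ F 0 + ∑ n (F ∘ suc)
  ∑-shift zero F = refl
  ∑-shift (suc n) F = begin
    ∑ (suc (suc n)) F                          ≡⟨ ∑-snoc (suc n) F ⟩
    ∑ (suc n) F + F (suc (suc n))              ≡⟨ cong (_+ F (suc (suc n))) (∑-shift n F) ⟩
    (F 0 + ∑ n (F ∘ suc)) + F (suc (suc n))    ≡⟨ ℤ.+-assoc (F 0) _ _ ⟩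
    F 0 + (∑ n (F ∘ suc) + F (suc (suc n)))    ≡⟨ cong (_+_ (F 0)) (∑-snoc n (F ∘ suc)) ⟨
    F 0 + ∑ (suc n) (F ∘ suc)                  ∎
    where open ≡-Reasoning

  ∑-cong : ∀ n {F G} → (∀ i → i ≤ n → F i ≡ G i) → ∑ n F ≡ ∑ n G
  ∑-cong zero F≗G = cong (λ a → a + + 0) (F≗G 0 z≤n)
  ∑-cong (suc n) {F} {G} F≗G = begin
    ∑ (suc n) F          ≡⟨ ∑-snoc n F ⟩
    ∑ n F + F (suc n)    ≡⟨ cong₂ _+_ (∑-cong n (λ i i≤n → F≗G i (ℕ.m≤n⇒m≤1+n i≤n))) (F≗G (suc n) ℕ.≤-refl) ⟩
    ∑ n G + G (suc n)    ≡⟨ ∑-snoc n G ⟨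
    ∑ (suc n) G          ∎
    where open ≡-Reasoning

  ∑-distrib-+ : ∀ n F G → ∑ n (λ i → F i + G i) ≡ ∑ n F + ∑ n G
  ∑-distrib-+ n F G = go (upTo' n)
    where
    interchange : ∀ a b c d → (a + b) + (c + d) ≡ (a + c) + (b + d)
    interchange = solve-∀
    go : ∀ xs → foldr _+_ (+ 0) (map (λ i → F i + G i) xs) ≡ foldr _+_ (+ 0) (map F xs) + foldr _+_ (+ 0) (map G xs)
    go [] = refl
    go (x ∷ xs) = trans (cong (_+_ (F x + G x)) (go xs)) (interchange (F x) (G x) _ _)

  ∑-distrib-minus : ∀ n F G → ∑ n (λ i → F i - G i) ≡ ∑ n F - ∑ n G
  ∑-distrib-minus n F G = go (upTo' n)
    where
    interchange : ∀ a b c d → (a - b) + (c - d) ≡ (a + c) - (b + d)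
    interchange = solve-∀
    go : ∀ xs → foldr _+_ (+ 0) (map (λ i → F i - G i) xs) ≡ foldr _+_ (+ 0) (map F xs) - foldr _+_ (+ 0) (map G xs)
    go [] = refl
    go (x ∷ xs) = trans (cong (_+_ (F x - G x)) (go xs)) (interchange (F x) (G x) _ _)

  ∑-reverse : ∀ n F → ∑ n F ≡ ∑ n (λ i → F (n ∸ i))
  ∑-reverse zero F = refl
  ∑-reverse (suc n) F = begin
    ∑ (suc n) F                            ≡⟨ ∑-snoc n F ⟩
    ∑ n F + F (suc n)                      ≡⟨ cong (_+ F (suc n)) (∑-reverse n F) ⟩
    ∑ n (λ i → F (n ∸ i)) + F (suc n)      ≡⟨ ℤ.+-comm _ (F (suc n)) ⟩
    F (suc n) + ∑ n (λ i → F (n ∸ i))      ≡⟨ ∑-shift n (λ i → F (suc n ∸ i)) ⟨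
    ∑ (suc n) (λ i → F (suc n ∸ i))        ∎
    where open ≡-Reasoning

  ∑-zero : ∀ n → ∑ n (λ _ → + 0) ≡ + 0
  ∑-zero zero = refl
  ∑-zero (suc n) = trans (∑-snoc n _) (trans (ℤ.+-identityʳ _) (∑-zero n))

  +-sum : ∀ (F : ℕ → ℕ) xs → + sum (map F xs) ≡ foldr _+_ (+ 0) (map (+_ ∘ F) xs)
  +-sum F [] = refl
  +-sum F (x ∷ xs) = trans (ℤ.pos-+ (F x) (sum (map F xs))) (cong (_+_ (+ F x)) (+-sum F xs))

  ⊛-comm : ∀ f g n → (f ⊛ g) n ≡ (g ⊛ f) n
  ⊛-comm f g n = trans (∑-reverse n _) (∑-cong n λ i i≤n →
    trans (cong (λ k → f (n ∸ i) * g k) (ℕ.m∸[m∸n]≡n i≤n)) (ℤ.*-comm (f (n ∸ i)) (g i)))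

  ⊛-congˡ : ∀ {f g} h n → (∀ i → f i ≡ g i) → (f ⊛ h) n ≡ (g ⊛ h) n
  ⊛-congˡ h n f≗g = ∑-cong n (λ i _ → cong (_* h (n ∸ i)) (f≗g i))

  ⊛-congʳ : ∀ f {g h} n → (∀ i → g i ≡ h i) → (f ⊛ g) n ≡ (f ⊛ h) n
  ⊛-congʳ f n g≗h = ∑-cong n (λ i _ → cong (f i *_) (g≗h (n ∸ i)))

  ⊛-distribˡ-⊕ : ∀ f g h n → (f ⊛ (g ⊕ h)) n ≡ (f ⊛ g) n + (f ⊛ h) n
  ⊛-distribˡ-⊕ f g h n = trans (∑-cong n (λ i _ → ℤ.*-distribˡ-+ (f i) (g (n ∸ i)) (h (n ∸ i)))) (∑-distrib-+ n _ _)

  ⊛-distribʳ-⊕ : ∀ f g h n → ((f ⊕ g) ⊛ h) n ≡ (f ⊛ h) n + (g ⊛ h) n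
  ⊛-distribʳ-⊕ f g h n = trans (∑-cong n (λ i _ → ℤ.*-distribʳ-+ (h (n ∸ i)) (f i) (g i))) (∑-distrib-+ n _ _)

  ⊛-distribˡ-⊖ : ∀ f g h n → (f ⊛ (g ⊖ h)) n ≡ (f ⊛ g) n - (f ⊛ h) n
  ⊛-distribˡ-⊖ f g h n = trans (∑-cong n (λ i _ → distrib (f i) (g (n ∸ i)) (h (n ∸ i)))) (∑-distrib-minus n _ _)
    where
    distrib : ∀ a b c → a * (b - c) ≡ a * b - a * c
    distrib = solve-∀

  ⊛-shift : ∀ g f n → g 0 ≡ + 0 → (g ⊛ f) (suc n) ≡ ((g ∘ suc) ⊛ f) n
  ⊛-shift g f n g0≡0 = trans (∑-shift n _) (trans (cong (λ c → c * f (suc n) + ((g ∘ suc) ⊛ f) n) g0≡0) (ℤ.+-identityˡ _))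

  oneS-⊛ : ∀ f n → (oneS ⊛ f) n ≡ f n
  oneS-⊛ f zero = trans (ℤ.+-identityʳ _) (ℤ.*-identityˡ (f 0))
  oneS-⊛ f (suc n) = trans (∑-shift n _) (trans (cong₂ _+_ (ℤ.*-identityˡ (f (suc n))) (∑-zero n)) (ℤ.+-identityʳ _))

  ⊛-oneS : ∀ f n → (f ⊛ oneS) n ≡ f n
  ⊛-oneS f n = trans (⊛-comm f oneS n) (oneS-⊛ f n)

  xS-⊛ : ∀ f n → (xS ⊛ f) (suc n) ≡ f n
  xS-⊛ f n = trans (⊛-shift xS f n refl) (trans (⊛-congˡ f n xS∘suc) (oneS-⊛ f n))
    where
    xS∘suc : ∀ i → xS (suc i) ≡ oneS i
    xS∘suc zero = refl
    xS∘suc (suc i) = refl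

  x²S-⊛ : ∀ f n → (x²S ⊛ f) (suc n) ≡ (xS ⊛ f) n
  x²S-⊛ f n = trans (⊛-shift x²S f n refl) (⊛-congˡ f n x²S∘suc)
    where
    x²S∘suc : ∀ i → x²S (suc i) ≡ xS i
    x²S∘suc zero = refl
    x²S∘suc (suc zero) = refl
    x²S∘suc (suc (suc i)) = refl

  E : Series → Series
  E S = (oneS ⊖ xS) ⊖ (x²S ⊛ S)

  ⊛-x²S⊛ : ∀ f S m → (f ⊛ (x²S ⊛ S)) (suc (suc m)) ≡ (f ⊛ S) m
  ⊛-x²S⊛ f S m = begin
    (f ⊛ T) (suc (suc m))              ≡⟨ ⊛-comm f T (suc (suc m)) ⟩
    (T ⊛ f) (suc (suc m))              ≡⟨ ⊛-shift T f (suc m) refl ⟩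
    ((T ∘ suc) ⊛ f) (suc m)            ≡⟨ ⊛-shift (T ∘ suc) f m refl ⟩
    ((T ∘ suc ∘ suc) ⊛ f) m            ≡⟨ ⊛-congˡ f m (λ i → trans (x²S-⊛ S (suc i)) (xS-⊛ S i)) ⟩
    (S ⊛ f) m                          ≡⟨ ⊛-comm S f m ⟩
    (f ⊛ S) m                          ∎
    where
    open ≡-Reasoning
    T = x²S ⊛ S

  ⊛E : ∀ f S n → (f ⊛ E S) n ≡ (f n - (f ⊛ xS) n) - (f ⊛ (x²S ⊛ S)) n
  ⊛E f S n = trans (⊛-distribˡ-⊖ f (oneS ⊖ xS) (x²S ⊛ S) n)
    (cong (_- (f ⊛ (x²S ⊛ S)) n) (trans (⊛-distribˡ-⊖ f oneS xS n) (cong (_- (f ⊛ xS) n) (⊛-oneS f n))))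

  ⊛E-0 : ∀ f S → (f ⊛ E S) 0 ≡ f 0
  ⊛E-0 f S = trans (⊛E f S 0) (trans (cong₂ (λ a b → (f 0 - a) - b) (⊛-comm f xS 0) (⊛-comm f (x²S ⊛ S) 0))
    (trans (ℤ.+-identityʳ _) (ℤ.+-identityʳ _)))

  ⊛E-1 : ∀ f S → (f ⊛ E S) 1 ≡ f 1 - f 0
  ⊛E-1 f S = trans (⊛E f S 1) (trans (cong₂ (λ a b → (f 1 - a) - b) (trans (⊛-comm f xS 1) (xS-⊛ f 0)) (⊛-comm f (x²S ⊛ S) 1))
    (ℤ.+-identityʳ _))

  ⊛E-2+ : ∀ f S m → (f ⊛ E S) (suc (suc m)) ≡ (f (suc (suc m)) - f (suc m)) - (f ⊛ S) m
  ⊛E-2+ f S m = trans (⊛E f S (suc (suc m)))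
    (cong₂ (λ a b → (f (suc (suc m)) - a) - b) (trans (⊛-comm f xS (suc (suc m))) (xS-⊛ f (suc m))) (⊛-x²S⊛ f S m))

  recurrence⇒⊛E≈oneS : ∀ f S → f 0 ≡ + 1 → f 1 ≡ f 0 → (∀ m → f (suc (suc m)) ≡ f (suc m) + (S ⊛ f) m) →
    (f ⊛ E S) ≈S oneS
  recurrence⇒⊛E≈oneS f S f0 f1 rec zero = trans (⊛E-0 f S) f0
  recurrence⇒⊛E≈oneS f S f0 f1 rec (suc zero) = trans (⊛E-1 f S) (trans (cong (_- f 0) f1) (ℤ.+-inverseʳ (f 0)))
  recurrence⇒⊛E≈oneS f S f0 f1 rec (suc (suc m)) = begin
    (f ⊛ E S) (suc (suc m))                                  ≡⟨ ⊛E-2+ f S m ⟩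
    (f (suc (suc m)) - f (suc m)) - (f ⊛ S) m                ≡⟨ cong₂ (λ a b → (a - f (suc m)) - b) (rec m) (⊛-comm f S m) ⟩
    ((f (suc m) + (S ⊛ f) m) - f (suc m)) - (S ⊛ f) m        ≡⟨ cancel (f (suc m)) ((S ⊛ f) m) ⟩
    + 0                                                      ∎
    where
    open ≡-Reasoning
    cancel : ∀ a s → ((a + s) - a) - s ≡ + 0
    cancel = solve-∀

  ⊛-cancelʳ : ∀ {f g D} → D 0 ≡ + 1 → (∀ n → (f ⊛ D) n ≡ (g ⊛ D) n) → ∀ n → f n ≡ g n
  ⊛-cancelʳ {f} {g} {D} D0≡1 f⊛D≗g⊛D n = agree n n ℕ.≤-refl
    where
    first : ∀ h → (h ⊛ D) 0 ≡ h 0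
    first h = trans (ℤ.+-identityʳ _) (trans (cong (h 0 *_) D0≡1) (ℤ.*-identityʳ (h 0)))
    last : ∀ h n → (h ⊛ D) (suc n) ≡ ∑ n (λ i → h i * D (suc n ∸ i)) + h (suc n)
    last h n = trans (∑-snoc n _) (cong (_+_ (∑ n (λ i → h i * D (suc n ∸ i))))
      (trans (cong (λ k → h (suc n) * D k) (ℕ.n∸n≡0 n)) (trans (cong (h (suc n) *_) D0≡1) (ℤ.*-identityʳ _))))
    agree : ∀ n i → i ≤ n → f i ≡ g i
    agree zero .zero z≤n = trans (sym (first f)) (trans (f⊛D≗g⊛D 0) (first g))
    agree (suc n) i i≤n+1 with ℕ.m≤n⇒m<n∨m≡n i≤n+1
    ... | inj₁ i<n+1 = agree n i (ℕ.≤-pred i<n+1)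
    ... | inj₂ refl = ∙-cancelˡ (∑ n (λ i → f i * D (suc n ∸ i))) (f (suc n)) (g (suc n)) (begin
      ∑ n (λ i → f i * D (suc n ∸ i)) + f (suc n)   ≡⟨ last f n ⟨
      (f ⊛ D) (suc n)                               ≡⟨ f⊛D≗g⊛D (suc n) ⟩
      (g ⊛ D) (suc n)                               ≡⟨ last g n ⟩
      ∑ n (λ i → g i * D (suc n ∸ i)) + g (suc n)   ≡⟨ cong (_+ g (suc n)) (∑-cong n (λ j j≤n → cong (_* D (suc n ∸ j)) (agree n j j≤n))) ⟨
      ∑ n (λ i → f i * D (suc n ∸ i)) + g (suc n)   ∎)
      where
      open ≡-Reasoning

  ⊛E-identity : ∀ C A D B Ñ → C 0 ≡ + 1 → C 1 ≡ C 0 →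
    (∀ m → C (suc (suc m)) ≡ C (suc m) + ((A ⊛ C) m + (D ⊛ B) m)) → (∀ n → C n ≡ A n + D n) → (∀ n → Ñ n ≡ B n) →
    (C ⊛ E (A ⊕ Ñ)) ≈S (oneS ⊖ (x²S ⊛ (A ⊛ Ñ)))
  ⊛E-identity C A D B Ñ c0 c1 rec C≗A+D Ñ≗B zero = trans (⊛E-0 C (A ⊕ Ñ)) c0
  ⊛E-identity C A D B Ñ c0 c1 rec C≗A+D Ñ≗B (suc zero) =
    trans (⊛E-1 C (A ⊕ Ñ)) (trans (cong (_- C 0) c1) (ℤ.+-inverseʳ (C 0)))
  ⊛E-identity C A D B Ñ c0 c1 rec C≗A+D Ñ≗B (suc (suc m)) = begin
    (C ⊛ E (A ⊕ Ñ)) (suc (suc m))                            ≡⟨ ⊛E-2+ C (A ⊕ Ñ) m ⟩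
    (C (suc (suc m)) - C (suc m)) - (C ⊛ (A ⊕ Ñ)) m          ≡⟨ cong₂ (λ a b → (a - C (suc m)) - b) (rec m) C⊛[A⊕Ñ] ⟩
    ((C (suc m) + (AC + DB)) - C (suc m)) - (AC + (AB + DB))  ≡⟨ cancel (C (suc m)) AC AB DB ⟩
    + 0 - AB                                                 ≡⟨ cong (λ z → + 0 - z) x²S⊛AÑ ⟨
    (oneS ⊖ (x²S ⊛ (A ⊛ Ñ))) (suc (suc m))                   ∎
    where
    open ≡-Reasoning
    AC = (A ⊛ C) m
    AB = (A ⊛ B) m
    DB = (D ⊛ B) m
    cancel : ∀ c x z y → ((c + (x + y)) - c) - (x + (z + y)) ≡ + 0 - z
    cancel = solve-∀
    C⊛[A⊕Ñ] : (C ⊛ (A ⊕ Ñ)) m ≡ AC + (AB + DB)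
    C⊛[A⊕Ñ] = begin
      (C ⊛ (A ⊕ Ñ)) m            ≡⟨ ⊛-distribˡ-⊕ C A Ñ m ⟩
      (C ⊛ A) m + (C ⊛ Ñ) m      ≡⟨ cong₂ _+_ (⊛-comm C A m) (⊛-congʳ C m Ñ≗B) ⟩
      AC + (C ⊛ B) m             ≡⟨ cong (_+_ AC) (trans (⊛-congˡ B m C≗A+D) (⊛-distribʳ-⊕ A D B m)) ⟩
      AC + (AB + DB)             ∎
    x²S⊛AÑ : (x²S ⊛ (A ⊛ Ñ)) (suc (suc m)) ≡ AB
    x²S⊛AÑ = trans (x²S-⊛ (A ⊛ Ñ) (suc m)) (trans (xS-⊛ (A ⊛ Ñ) m) (⊛-congʳ A m Ñ≗B))

  +-sum-⊛ : ∀ (a b : ℕ → ℕ) m → + sum (map (λ i → a i ℕ.* b (m ∸ i)) (upTo' m)) ≡ ((+_ ∘ a) ⊛ (+_ ∘ b)) m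
  +-sum-⊛ a b m = trans (+-sum _ (upTo' m)) (∑-cong m (λ i _ → ℤ.pos-* (a i) (b (m ∸ i))))

  +-sum-⊛+⊛ : ∀ (a c d b : ℕ → ℕ) m → + sum (map (λ i → a i ℕ.* c (m ∸ i) ℕ.+ d i ℕ.* b (m ∸ i)) (upTo' m)) ≡
    ((+_ ∘ a) ⊛ (+_ ∘ c)) m + ((+_ ∘ d) ⊛ (+_ ∘ b)) m
  +-sum-⊛+⊛ a c d b m = trans (+-sum _ (upTo' m)) (trans
    (∑-cong m (λ i _ → trans (ℤ.pos-+ (a i ℕ.* c (m ∸ i)) _) (cong₂ _+_ (ℤ.pos-* (a i) _) (ℤ.pos-* (d i) _))))
    (∑-distrib-+ m _ _))



open Enumeration
open PowerSeries
open import Data.Nat using (suc)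
import Data.Integer as ℤ
import Data.Integer.Properties as ℤ
open import Relation.Binary.PropositionalEquality using (refl; sym; trans; cong)

theorem3p8 : (k t : ℕ) (ρ′ θ′ : List ℕ) →
    (ρ′ ++ (t ∷ k ∷ [])) ++ (θ′ ++ (1 ∷ (t ∸ 1) ∷ [])) ∈ perms k →
    isMotzkin ((ρ′ ++ (t ∷ k ∷ [])) ++ (θ′ ++ (1 ∷ (t ∸ 1) ∷ []))) ≡ true →
    All (λ a → t < a) ρ′ → All (λ b → b < t) θ′ →
    (Ñθ : Series) →
    (Ñθ ⊛ ((oneS ⊖ xS) ⊖ (x²S ⊛ N (map (λ b → b ∸ 1) θ′)))) ≈S oneS →
    (N ((ρ′ ++ (t ∷ k ∷ [])) ++ (θ′ ++ (1 ∷ (t ∸ 1) ∷ [])))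
      ⊛ ((oneS ⊖ xS) ⊖ (x²S ⊛ (N (map (λ a → a ∸ t) ρ′) ⊕ Ñθ))))
      ≈S (oneS ⊖ (x²S ⊛ (N (map (λ a → a ∸ t) ρ′) ⊛ Ñθ)))
theorem3p8 k t ρ′ θ′ τ∈ _ ρ′>t θ′<t Ñθ Ñθ-inverse =
  ⊛E-identity (N τ) (N ρ) D (N τ₂) Ñθ (cong ℤ.+_ τ-count-zero) (cong ℤ.+_ τ-count-one) C-recurrence
    (λ n → trans (cong ℤ.+_ (τ-count-split n)) (ℤ.pos-+ (countM ρ n) (d n))) Ñθ≗B
  where
  open Pattern k t ρ′ θ′ τ∈ ρ′>t θ′<t
  open Recurrences k t ρ′ θ′ τ∈ ρ′>t θ′<t
  D : Series
  D n = ℤ.+ d n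
  C-recurrence : ∀ m → N τ (suc (suc m)) ≡ N τ (suc m) ℤ.+ ((N ρ ⊛ N τ) m ℤ.+ (D ⊛ N τ₂) m)
  C-recurrence m = trans (cong ℤ.+_ (τ-count-recurrence m)) (trans (ℤ.pos-+ (countM τ (suc m)) _)
    (cong (ℤ._+_ (N τ (suc m))) (+-sum-⊛+⊛ (countM ρ) (countM τ) d (countM τ₂) m)))
  B-inverse : (N τ₂ ⊛ E (N θ)) ≈S oneS
  B-inverse = recurrence⇒⊛E≈oneS (N τ₂) (N θ) (cong ℤ.+_ τ₂-count-zero) (cong ℤ.+_ τ₂-count-one)
    (λ m → trans (cong ℤ.+_ (τ₂-count-recurrence m)) (trans (ℤ.pos-+ (countM τ₂ (suc m)) _)
      (cong (ℤ._+_ (N τ₂ (suc m))) (+-sum-⊛ (countM θ) (countM τ₂) m))))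
  Ñθ≗B : ∀ n → Ñθ n ≡ N τ₂ n
  Ñθ≗B = ⊛-cancelʳ {D = E (N θ)} refl (λ n → trans (Ñθ-inverse n) (sym (B-inverse n)))
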